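{- Let $n\ge2$ and let $\vec w=(w_1,\ldots,w_n)$ be positive integers with $\sum_i w_i=W$. Let $\mathbf{F}$ be the random forest distributed according to $\vec w$ and $\mathbf{T}$ the random weighted tree. Then \[ \mathbf{P}(\mathbf{F}\in\mathcal{F}_{n,2})\ =\ \mathbf{P}(\mathbf{F}\in\mathcal{F}_{n,1})\cdot\sum_{i=1}^{\lfloor W/2\rfloor}\frac{\mathbf{E}[c(\mathbf{T},i)]}{i(W-i)}. \]
   Context: $\mathcal{F}_n$ is the set of forests on $[n]=\{1,\ldots,n\}$; for $F\in\mathcal{F}_n$, $\mathrm{mass}(F)=\prod_{i=1}^n w_i^{d_F(i)}$ with $d_F(i)$ the degree of $i$ in $F$; $K=\sum_{F\in\mathcal{F}_n}\mathrm{mass}(F)$; $\mathbf{F}$ is the random element of $\mathcal{F}_n$ with $\mathbf{P}(\mathbf{F}=F)=\mathrm{mass}(F)/K$. $\mathcal{F}_{n,i}$ is the set of forests in $\mathcal{F}_n$ with exactly $i$ components (so $\mathcal{F}_{n,1}$ is the set of trees on $[n]$). Let $K'=\sum_{T\in\mathcal{F}_{n,1}}\mathrm{mass}(T)$ and let $\mathbf{T}$ be the random tree on $[n]$ with $\mathbf{P}(\mathbf{T}=T)=\mathrm{mass}(T)/K'$. For a set $I\subseteq[n]$ (or a subtree with vertex set $I$) let $w(I)=\sum_{i\in I}w_i$. For a tree $T$ on $[n]$ and an edge $e$ of $T$, $s(T,e)$ denotes the component of $T-e$ of smaller weight, or the component containing vertex $1$ if the two components have equal weight. For $i=1,\ldots,\lfloor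 W/2\rfloor$, $c(T,i)$ is the number of edges $e$ of $T$ with $w(s(T,e))=i$. -}

module Defs where

open import Data.Bool using (Bool; true; false; _∧_; _∨_; not; if_then_else_)
open import Data.Nat as ℕ using (ℕ; zero; suc; _≤_; _^_; _≡ᵇ_; _<ᵇ_)
open import Data.Nat.DivMod using (_/_)
open import Data.Fin as Fin using (Fin; toℕ)
open import Data.List using (List; []; _∷_; map; filterᵇ; length; foldr; concatMap; allFin; upTo)
open import Data.Bool.ListAction using (any)
open import Data.Product using (_×_; _,_; proj₁; proj₂)
open import Data.Integer using (+_)
open import Data.Rational as ℚ using (ℚ; 0ℚ)
open import Relation.Nullary.Decidable using (⌊_⌋; does)
open import Relation.Unary using (Pred)

-- Boolean helpers on vertices of [n] = Fin n (vertex i+1 of the paper is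
-- the element of Fin n with toℕ = i; so "vertex 1" is Fin.zero).

Vertex : ℕ → Set
Vertex n = Fin n

_==_ : ∀ {n} → Fin n → Fin n → Bool
u == v = ⌊ u Fin.≟ v ⌋

_<F_ : ∀ {n} → Fin n → Fin n → Bool
u <F v = toℕ u <ᵇ toℕ v

sumℕ : List ℕ → ℕ
sumℕ = foldr ℕ._+_ 0

prodℕ : List ℕ → ℕ
prodℕ = foldr ℕ._*_ 1

count : ∀ {A : Set} → (A → Bool) → List A → ℕ
count p xs = length (filterᵇ p xs)

-- Simple graphs on [n]: an edge is a pair (u , v) with u < v; a graph is
-- a list of distinct such edges, i.e. a sublist of the list of all pairs.

Edge : ℕ → Set
Edge n = Fin n × Fin n

Graph : ℕ → Set
Graph n = List (Edge n)

allPairs : (n : ℕ) → List (Edge n)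
allPairs n = concatMap (λ u → map (λ v → (u , v)) (filterᵇ (u <F_) (allFin n))) (allFin n)

sublists : ∀ {A : Set} → List A → List (List A)
sublists [] = [] ∷ []
sublists (x ∷ xs) = let r = sublists xs in r Data.List.++ map (x ∷_) r
  where import Data.List

allGraphs : (n : ℕ) → List (Graph n)
allGraphs n = sublists (allPairs n)

adj : ∀ {n} → Graph n → Fin n → Fin n → Bool
adj E u v = any (λ e → ((proj₁ e == u) ∧ (proj₂ e == v)) ∨ ((proj₁ e == v) ∧ (proj₂ e == u))) E

deg : ∀ {n} → Graph n → Fin n → ℕ
deg E i = count (λ e → (proj₁ e == i) ∨ (proj₂ e == i)) E

elemF : ∀ {n} → Fin n → List (Fin n) → Bool
elemF v = any (_== v)

distinct : ∀ {n} → List (Fin n) → Bool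
distinct [] = true
distinct (x ∷ xs) = not (elemF x xs) ∧ distinct xs

vlists : (n k : ℕ) → List (List (Fin n))
vlists n zero = [] ∷ []
vlists n (suc k) = concatMap (λ v → map (v ∷_) (vlists n k)) (allFin n)

last : ∀ {A : Set} → A → List A → A
last a [] = a
last a (x ∷ xs) = last x xs

pathAdj : ∀ {n} → Graph n → List (Fin n) → Bool
pathAdj E [] = true
pathAdj E (x ∷ []) = true
pathAdj E (x ∷ y ∷ xs) = adj E x y ∧ pathAdj E (y ∷ xs)

isCycle : ∀ {n} → Graph n → List (Fin n) → Bool
isCycle E [] = false
isCycle E (v₀ ∷ vs) = (2 <ᵇ length (v₀ ∷ vs)) ∧ distinct (v₀ ∷ vs) ∧ pathAdj E (v₀ ∷ vs) ∧ adj E (last v₀ vs) v₀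

-- a cycle has at most n distinct vertices
hasCycle : ∀ {n} → Graph n → Bool
hasCycle {n} E = any (λ k → any (isCycle E) (vlists n k)) (upTo (suc n))

isForest : ∀ {n} → Graph n → Bool
isForest E = not (hasCycle E)

reachW : ∀ {n} → Graph n → ℕ → Fin n → Fin n → Bool
reachW E zero u v = u == v
reachW {n} E (suc k) u v = reachW E k u v ∨ any (λ x → reachW E k u x ∧ adj E x v) (allFin n)

-- u and v lie in the same connected component (walks of length ≤ n suffice)
connected : ∀ {n} → Graph n → Fin n → Fin n → Bool
connected {n} E u v = reachW E n u v

-- number of connected components = number of vertices that are the
-- smallest vertex of their component
components : ∀ {n} → Graph n → ℕ
components {n} E = count (λ v → not (any (λ u → (u <F v) ∧ connected E v u) (allFin n))) (allFin n)

forests : (n : ℕ) → List (Graph n)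
forests n = filterᵇ isForest (allGraphs n)

forestsWith : (n i : ℕ) → List (Graph n)
forestsWith n i = filterᵇ (λ F → components F ≡ᵇ i) (forests n)

Weights : ℕ → Set
Weights n = Fin n → ℕ

totalWeight : ∀ {n} → Weights n → ℕ
totalWeight {n} w = sumℕ (map w (allFin n))

mass : ∀ {n} → Weights n → Graph n → ℕ
mass {n} w F = prodℕ (map (λ i → w i ^ deg F i) (allFin n))

massSum : ∀ {n} → Weights n → List (Graph n) → ℕ
massSum w Fs = sumℕ (map (mass w) Fs)

K : ∀ {n} → Weights n → ℕ
K {n} w = massSum w (forests n)

K′ : ∀ {n} → Weights n → ℕ
K′ {n} w = massSum w (forestsWith n 1)

-- Rational arithmetic.  frac p q = p / q for q ≥ 1 (all denominators used
-- below are positive; the value at q = 0 is never used).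

frac : ℕ → ℕ → ℚ
frac p zero = 0ℚ
frac p (suc q) = (+ p) ℚ./ suc q

sumℚ : List ℚ → ℚ
sumℚ = foldr ℚ._+_ 0ℚ

-- Probability P(𝐅 ∈ 𝓕_{n,i}) for the random forest 𝐅 with
-- P(𝐅 = F) = mass(F)/K.

probForestComponents : ∀ {n} → Weights n → ℕ → ℚ
probForestComponents {n} w i = frac (massSum w (forestsWith n i)) (K w)

splits : ∀ {A : Set} → List A → List (A × List A)
splits [] = []
splits (x ∷ xs) = (x , xs) ∷ map (λ p → proj₁ p , x ∷ proj₂ p) (splits xs)

compWeight : ∀ {n} → Weights n → Graph n → Fin n → ℕ
compWeight {n} w G v = sumℕ (map w (filterᵇ (connected G v) (allFin n)))

-- For T − e (= G) with e = (a , b): the endpoint whose component is s(T,e):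
-- the component of smaller weight, or the one containing vertex 1 on a tie.
sRoot : ∀ {n} → Weights n → Graph n → Fin n → Fin n → Fin n
sRoot {zero} w G a b = a
sRoot {suc n} w G a b =
  if compWeight w G a <ᵇ compWeight w G b then a
  else if compWeight w G b <ᵇ compWeight w G a then b
  else (if connected G a Fin.zero then a else b)

sWeight : ∀ {n} → Weights n → Edge n → Graph n → ℕ
sWeight w (a , b) G = compWeight w G (sRoot w G a b)

c : ∀ {n} → Weights n → Graph n → ℕ → ℕ
c w T i = count (λ p → sWeight w (proj₁ p) (proj₂ p) ≡ᵇ i) (splits T)

-- E[c(𝐓,i)] for the random tree 𝐓 with P(𝐓 = T) = mass(T)/K'
expC : ∀ {n} → Weights n → ℕ → ℚ
expC {n} w i = frac (sumℕ (map (λ T → mass w T ℕ.* c w T i) (forestsWith n 1))) (K′ w)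

rhsSum : ∀ {n} → Weights n → ℚ
rhsSum w = sumℚ (map (λ j → let i = suc j in expC w i ℚ.* frac 1 (i ℕ.* (W ℕ.∸ i))) (upTo (W / 2)))
  where W = totalWeight w

-- Clearing denominators, the claim is the mass identity
--   Σ_{G two-forest} mass G = Σ_{T tree} Σ_{e ∈ T} mass T / (s(W − s)),
-- with s = w(s(T,e)), since Σ_i c(T,i)/(i(W−i)) runs over the edges of T.
-- Both sides are compared through the bijection (T , e) ↦ (G , e), G = T − e:
-- T is a tree exactly when G is a two-forest and e joins its two components
-- A, B; then mass T = mass G · w a · w b and s(W − s) = w(A) w(B), while the
-- crossing pairs have total weight Σ w a w b = w(A) w(B).  So the trees
-- through a fixed G contribute exactly mass G.
module Submission where

module Basics where

  open import Defs
  open import Data.Bool using (Bool; true; false; _∧_; _∨_; not)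
  open import Data.Bool.Properties using (∨-assoc)
  open import Data.Fin as Fin using (Fin)
  open import Data.List using (List; []; _∷_; map; length; _++_)
  open import Data.Bool.ListAction using (any)
  open import Data.Product using (_×_; _,_; ∃)
  open import Data.Sum using (_⊎_; inj₁; inj₂)
  open import Data.Empty using (⊥; ⊥-elim)
  open import Relation.Nullary using (¬_; yes; no)
  open import Relation.Binary.PropositionalEquality
  open import Data.List.Membership.Propositional using (_∈_)
  open import Data.List.Membership.Propositional.Properties using (∈-map⁺; ∈-concat⁺′; ∈-allFin)
  open import Data.List.Relation.Unary.Any using (here; there)

  ∧-in : ∀ {a b} → a ≡ true → b ≡ true → a ∧ b ≡ true
  ∧-in refl refl = refl

  ∧-l : ∀ {a b} → a ∧ b ≡ true → a ≡ true
  ∧-l {true} _ = refl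

  ∧-r : ∀ {a b} → a ∧ b ≡ true → b ≡ true
  ∧-r {true} p = p

  ∨-l : ∀ {a} b → a ≡ true → a ∨ b ≡ true
  ∨-l b refl = refl

  ∨-r : ∀ a {b} → b ≡ true → a ∨ b ≡ true
  ∨-r true _ = refl
  ∨-r false p = p

  ∨-el : ∀ {a b} → a ∨ b ≡ true → a ≡ true ⊎ b ≡ true
  ∨-el {true} _ = inj₁ refl
  ∨-el {false} p = inj₂ p

  ∨-f : ∀ {a b} → a ∨ b ≡ false → a ≡ false × b ≡ false
  ∨-f {false} p = refl , p

  not-t : ∀ {a} → not a ≡ true → a ≡ false
  not-t {false} _ = refl

  not-f : ∀ {a} → a ≡ false → not a ≡ true
  not-f refl = refl

  true≢false : ∀ {a} → a ≡ true → a ≡ false → ⊥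
  true≢false refl ()

  ==-refl : ∀ {n} (u : Fin n) → (u == u) ≡ true
  ==-refl u with u Fin.≟ u
  ... | yes _ = refl
  ... | no ¬p = ⊥-elim (¬p refl)

  ==-sound : ∀ {n} {u v : Fin n} → (u == v) ≡ true → u ≡ v
  ==-sound {u = u} {v} p with u Fin.≟ v
  ... | yes q = q
  ==-sound {u = u} {v} () | no _

  ==-false : ∀ {n} {u v : Fin n} → ¬ u ≡ v → (u == v) ≡ false
  ==-false {u = u} {v} ne with u Fin.≟ v
  ... | yes q = ⊥-elim (ne q)
  ... | no _ = refl

  ==-sym : ∀ {n} (u v : Fin n) → (u == v) ≡ (v == u)
  ==-sym u v with u Fin.≟ v | v Fin.≟ u
  ... | yes _ | yes _ = refl
  ... | no _ | no _ = refl
  ... | yes p | no q = ⊥-elim (q (sym p))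
  ... | no p | yes q = ⊥-elim (p (sym q))

  any-in : ∀ {A : Set} (p : A → Bool) {x : A} {xs} → x ∈ xs → p x ≡ true → any p xs ≡ true
  any-in p {xs = y ∷ ys} (here refl) px = ∨-l _ px
  any-in p {xs = y ∷ ys} (there m) px = ∨-r (p y) (any-in p m px)

  any-el : ∀ {A : Set} (p : A → Bool) (xs : List A) → any p xs ≡ true → ∃ λ x → x ∈ xs × p x ≡ true
  any-el p (x ∷ xs) q with ∨-el {p x} q
  ... | inj₁ px = x , here refl , px
  ... | inj₂ r with any-el p xs r
  ... | y , m , py = y , there m , py

  any-mono : ∀ {A : Set} (p q : A → Bool) xs → (∀ x → p x ≡ true → q x ≡ true) → any p xs ≡ true → any q xs ≡ true
  any-mono p q xs h r with any-el p xs r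
  ... | x , m , px = any-in q m (h x px)

  any-++ : ∀ {A : Set} (p : A → Bool) (xs ys : List A) → any p (xs ++ ys) ≡ (any p xs ∨ any p ys)
  any-++ p [] ys = refl
  any-++ p (x ∷ xs) ys rewrite any-++ p xs ys = sym (∨-assoc (p x) (any p xs) (any p ys))

  any-cong : ∀ {A : Set} (p q : A → Bool) (xs : List A) → (∀ x → x ∈ xs → p x ≡ q x) → any p xs ≡ any q xs
  any-cong p q [] h = refl
  any-cong p q (x ∷ xs) h = cong₂ _∨_ (h x (here refl)) (any-cong p q xs (λ y m → h y (there m)))

  elemF-in : ∀ {n} {v : Fin n} {xs} → v ∈ xs → elemF v xs ≡ true
  elemF-in {v = v} m = any-in (_== v) m (==-refl v)

  ∈-vlists : ∀ {n} (xs : List (Fin n)) → xs ∈ vlists n (length xs)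
  ∈-vlists [] = here refl
  ∈-vlists {n} (x ∷ xs) = ∈-concat⁺′ (∈-map⁺ (x ∷_) (∈-vlists xs)) (∈-map⁺ (λ v → map (v ∷_) (vlists n (length xs))) (∈-allFin x))

  dist-hd : ∀ {n} (x : Fin n) xs → distinct (x ∷ xs) ≡ true → elemF x xs ≡ false
  dist-hd x xs d = not-t (∧-l {not (elemF x xs)} {distinct xs} d)

  dist-tl : ∀ {n} (x : Fin n) xs → distinct (x ∷ xs) ≡ true → distinct xs ≡ true
  dist-tl x xs d = ∧-r {not (elemF x xs)} {distinct xs} d

  dist-cons : ∀ {n} {x : Fin n} {xs} → elemF x xs ≡ false → distinct xs ≡ true → distinct (x ∷ xs) ≡ true
  dist-cons e d = ∧-in (not-f e) d

  path-hd : ∀ {n} (E : Graph n) x y xs → pathAdj E (x ∷ y ∷ xs) ≡ true → adj E x y ≡ true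
  path-hd E x y xs p = ∧-l {adj E x y} {pathAdj E (y ∷ xs)} p

  path-tl : ∀ {n} (E : Graph n) x y xs → pathAdj E (x ∷ y ∷ xs) ≡ true → pathAdj E (y ∷ xs) ≡ true
  path-tl E x y xs p = ∧-r {adj E x y} {pathAdj E (y ∷ xs)} p

  path-cons : ∀ {n} {E : Graph n} {x y xs} → adj E x y ≡ true → pathAdj E (y ∷ xs) ≡ true → pathAdj E (x ∷ y ∷ xs) ≡ true
  path-cons a p = ∧-in a p

module Sums where

  open import Defs
  open import Data.Bool using (Bool; true; false; if_then_else_)
  open import Data.Nat as ℕ using (ℕ; zero; suc)
  open import Data.Integer as ℤ using (+_)
  import Data.Integer.Properties as ℤP
  import Data.Nat.Properties as NP
  open import Data.Integer.Solver using () renaming (module +-*-Solver to ZS)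
  open import Data.Rational as ℚ using (ℚ; 0ℚ; 1ℚ; _+_; _*_; fromℚᵘ)
  open import Data.Rational.Properties as ℚP using ()
  open import Data.Rational.Unnormalised as U using (mkℚᵘ; *≡*)
  import Data.Rational.Unnormalised.Properties as UP
  open import Data.List using (List; []; _∷_; map; filterᵇ; concatMap; _++_; concat)
  open import Data.List.Membership.Propositional using (_∈_)
  open import Data.List.Relation.Unary.Any using (here; there)
  open import Relation.Binary.PropositionalEquality
  open import Function using (_∘_)

  fromU-+ : ∀ x y → fromℚᵘ (x U.+ y) ≡ fromℚᵘ x + fromℚᵘ y
  fromU-+ x y = ℚP.toℚᵘ-injective (UP.≃-trans (ℚP.toℚᵘ-fromℚᵘ (x U.+ y))
    (UP.≃-sym (UP.≃-trans (ℚP.toℚᵘ-homo-+ (fromℚᵘ x) (fromℚᵘ y)) (UP.+-cong (ℚP.toℚᵘ-fromℚᵘ x) (ℚP.toℚᵘ-fromℚᵘ y)))))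

  fromU-* : ∀ x y → fromℚᵘ (x U.* y) ≡ fromℚᵘ x * fromℚᵘ y
  fromU-* x y = ℚP.toℚᵘ-injective (UP.≃-trans (ℚP.toℚᵘ-fromℚᵘ (x U.* y))
    (UP.≃-sym (UP.≃-trans (ℚP.toℚᵘ-homo-* (fromℚᵘ x) (fromℚᵘ y)) (UP.*-cong (ℚP.toℚᵘ-fromℚᵘ x) (ℚP.toℚᵘ-fromℚᵘ y)))))

  ι : ℕ → ℚ
  ι k = frac k 1

  ι-+ : ∀ a b → ι (a ℕ.+ b) ≡ ι a + ι b
  ι-+ a b = trans (ℚP.fromℚᵘ-cong {mkℚᵘ (+ (a ℕ.+ b)) 0} {mkℚᵘ (+ a) 0 U.+ mkℚᵘ (+ b) 0} (*≡* eq)) (fromU-+ (mkℚᵘ (+ a) 0) (mkℚᵘ (+ b) 0))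
    where
    eq : + (a ℕ.+ b) ℤ.* + 1 ≡ (+ a ℤ.* + 1 ℤ.+ + b ℤ.* + 1) ℤ.* + 1
    eq = trans (cong (ℤ._* + 1) (ℤP.pos-+ a b)) (ZS.solve 2 (λ x y → (x ZS.:+ y) ZS.:* ZS.con (+ 1) ZS.:= (x ZS.:* ZS.con (+ 1) ZS.:+ y ZS.:* ZS.con (+ 1)) ZS.:* ZS.con (+ 1)) refl (+ a) (+ b))

  ι-* : ∀ a b → ι (a ℕ.* b) ≡ ι a * ι b
  ι-* a b = trans (ℚP.fromℚᵘ-cong {mkℚᵘ (+ (a ℕ.* b)) 0} {mkℚᵘ (+ a) 0 U.* mkℚᵘ (+ b) 0} (*≡* eq)) (fromU-* (mkℚᵘ (+ a) 0) (mkℚᵘ (+ b) 0))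
    where
    eq : + (a ℕ.* b) ℤ.* + 1 ≡ (+ a ℤ.* + b) ℤ.* + 1
    eq = cong (ℤ._* + 1) (ℤP.pos-* a b)

  -- 1/q (with 1/0 = 0, matching 'frac').
  inv : ℕ → ℚ
  inv q = frac 1 q

  frac-ι : ∀ p q → frac p q ≡ ι p * inv q
  frac-ι p zero = sym (ℚP.*-zeroʳ (ι p))
  frac-ι p (suc q) = trans (ℚP.fromℚᵘ-cong {mkℚᵘ (+ p) q} {mkℚᵘ (+ p) 0 U.* mkℚᵘ (+ 1) q} (*≡* eq)) (fromU-* (mkℚᵘ (+ p) 0) (mkℚᵘ (+ 1) q))
    where
    eq : + p ℤ.* + (1 ℕ.* suc q) ≡ (+ p ℤ.* + 1) ℤ.* + suc q
    eq = trans (cong (λ k → + p ℤ.* + k) (NP.*-identityˡ (suc q))) (ZS.solve 2 (λ x y → x ZS.:* y ZS.:= (x ZS.:* ZS.con (+ 1)) ZS.:* y) refl (+ p) (+ suc q))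

  ι-inv : ∀ q → ι (suc q) * inv (suc q) ≡ 1ℚ
  ι-inv q = trans (sym (fromU-* (mkℚᵘ (+ suc q) 0) (mkℚᵘ (+ 1) q))) (ℚP.fromℚᵘ-cong {mkℚᵘ (+ suc q) 0 U.* mkℚᵘ (+ 1) q} {mkℚᵘ (+ 1) 0} (*≡* eq))
    where
    eq : (+ suc q ℤ.* + 1) ℤ.* + 1 ≡ + 1 ℤ.* + (1 ℕ.* suc q)
    eq = trans (ZS.solve 1 (λ x → (x ZS.:* ZS.con (+ 1)) ZS.:* ZS.con (+ 1) ZS.:= ZS.con (+ 1) ZS.:* x) refl (+ suc q)) (cong (λ k → + 1 ℤ.* + k) (sym (NP.*-identityˡ (suc q))))

  Σ : ∀ {A : Set} → (A → ℚ) → List A → ℚ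
  Σ f xs = sumℚ (map f xs)

  Σ-++ : ∀ {A : Set} (f : A → ℚ) xs ys → Σ f (xs ++ ys) ≡ Σ f xs + Σ f ys
  Σ-++ f [] ys = sym (ℚP.+-identityˡ _)
  Σ-++ f (x ∷ xs) ys rewrite Σ-++ f xs ys = sym (ℚP.+-assoc (f x) _ _)

  Σ-cong : ∀ {A : Set} (f g : A → ℚ) xs → (∀ x → x ∈ xs → f x ≡ g x) → Σ f xs ≡ Σ g xs
  Σ-cong f g [] h = refl
  Σ-cong f g (x ∷ xs) h = cong₂ _+_ (h x (here refl)) (Σ-cong f g xs (λ y m → h y (there m)))

  Σ-0 : ∀ {A : Set} (f : A → ℚ) xs → (∀ x → x ∈ xs → f x ≡ 0ℚ) → Σ f xs ≡ 0ℚ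
  Σ-0 f [] h = refl
  Σ-0 f (x ∷ xs) h rewrite h x (here refl) | Σ-0 f xs (λ y m → h y (there m)) = refl

  Σ-+ : ∀ {A : Set} (f g : A → ℚ) xs → Σ (λ x → f x + g x) xs ≡ Σ f xs + Σ g xs
  Σ-+ f g [] = refl
  Σ-+ f g (x ∷ xs) rewrite Σ-+ f g xs = medial (f x) (g x) (Σ f xs) (Σ g xs)
    where
    open import Data.Rational.Solver using (module +-*-Solver)
    open +-*-Solver
    medial : ∀ a b c d → (a + b) + (c + d) ≡ (a + c) + (b + d)
    medial = solve 4 (λ a b c d → (a :+ b) :+ (c :+ d) := (a :+ c) :+ (b :+ d)) refl

  Σ-*ˡ : ∀ {A : Set} (c : ℚ) (f : A → ℚ) xs → Σ (λ x → c * f x) xs ≡ c * Σ f xs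
  Σ-*ˡ c f [] = sym (ℚP.*-zeroʳ c)
  Σ-*ˡ c f (x ∷ xs) rewrite Σ-*ˡ c f xs = sym (ℚP.*-distribˡ-+ c (f x) _)

  Σ-*ʳ : ∀ {A : Set} (c : ℚ) (f : A → ℚ) xs → Σ (λ x → f x * c) xs ≡ Σ f xs * c
  Σ-*ʳ c f xs = trans (Σ-cong _ _ xs (λ x _ → ℚP.*-comm (f x) c)) (trans (Σ-*ˡ c f xs) (ℚP.*-comm c _))

  Σ-map : ∀ {A B : Set} (f : B → ℚ) (g : A → B) xs → Σ f (map g xs) ≡ Σ (f ∘ g) xs
  Σ-map f g [] = refl
  Σ-map f g (x ∷ xs) rewrite Σ-map f g xs = refl

  Σ-concat : ∀ {A : Set} (f : A → ℚ) (xss : List (List A)) → Σ f (concat xss) ≡ Σ (Σ f) xss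
  Σ-concat f [] = refl
  Σ-concat f (xs ∷ xss) rewrite Σ-++ f xs (concat xss) | Σ-concat f xss = refl

  Σ-concatMap : ∀ {A B : Set} (f : B → ℚ) (g : A → List B) xs → Σ f (concatMap g xs) ≡ Σ (λ x → Σ f (g x)) xs
  Σ-concatMap f g xs = trans (Σ-concat f (map g xs)) (Σ-map (Σ f) g xs)

  Σ-filter : ∀ {A : Set} (f : A → ℚ) (p : A → Bool) xs → Σ f (filterᵇ p xs) ≡ Σ (λ x → if p x then f x else 0ℚ) xs
  Σ-filter f p [] = refl
  Σ-filter f p (x ∷ xs) with p x
  ... | true = cong (λ r → f x + r) (Σ-filter f p xs)
  ... | false = trans (Σ-filter f p xs) (sym (ℚP.+-identityˡ _))

  Σ-swap : ∀ {A B : Set} (f : A → B → ℚ) xs ys → Σ (λ x → Σ (f x) ys) xs ≡ Σ (λ y → Σ (λ x → f x y) xs) ys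
  Σ-swap f [] ys = sym (Σ-0 _ ys (λ _ _ → refl))
  Σ-swap f (x ∷ xs) ys rewrite Σ-swap f xs ys = sym (Σ-+ (f x) (λ y → Σ (λ x → f x y) xs) ys)

  ι-sum : ∀ {A : Set} (f : A → ℕ) xs → ι (sumℕ (map f xs)) ≡ Σ (ι ∘ f) xs
  ι-sum f [] = refl
  ι-sum f (x ∷ xs) = trans (ι-+ (f x) _) (cong (λ r → ι (f x) + r) (ι-sum f xs))

  ι-count : ∀ {A : Set} (p : A → Bool) xs → ι (count p xs) ≡ Σ (λ x → if p x then 1ℚ else 0ℚ) xs
  ι-count p [] = refl
  ι-count p (x ∷ xs) with p x
  ... | true = trans (ι-+ 1 (count p xs)) (cong (λ r → 1ℚ + r) (ι-count p xs))
  ... | false = trans (ι-count p xs) (sym (ℚP.+-identityˡ _))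

-- Walks compose and reverse; every walk contains a simple
-- path, and a simple path has at most n vertices (pigeonhole), so walks of
-- length ≤ n suffice.
module Walks where

  open import Defs
  open Basics
  open import Data.Bool using (true; false; _∧_; _∨_; if_then_else_)
  open import Data.Bool.Properties as BP using ()
  open import Data.Nat as ℕ using (ℕ; zero; suc; _≤_; _<_; _+_)
  open import Data.Nat.Properties as NP using ()
  open import Data.Fin as Fin using (Fin; toℕ)
  open import Data.Fin.Properties as FinP using ()
  open import Data.List using (List; []; _∷_; length; allFin; _++_; lookup)
  open import Data.Product using (_×_; _,_; proj₁; proj₂; Σ)
  open import Data.Sum using (inj₁; inj₂)
  open import Data.Empty using (⊥-elim)
  open import Relation.Nullary using (¬_; yes; no)
  open import Relation.Binary.PropositionalEquality
  open import Data.List.Membership.Propositional using (_∈_)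
  open import Data.List.Membership.Propositional.Properties using (∈-allFin; ∈-lookup)

  module _ {n : ℕ} {E : Graph n} where

    R-step : ∀ k u x v → reachW E k u x ≡ true → adj E x v ≡ true → reachW E (suc k) u v ≡ true
    R-step k u x v r a = ∨-r (reachW E k u v) (any-in (λ y → reachW E k u y ∧ adj E y v) (∈-allFin x) (∧-in r a))

    R-up : ∀ k u v → reachW E k u v ≡ true → reachW E (suc k) u v ≡ true
    R-up k u v r = ∨-l _ r

    R-up* : ∀ d k u v → reachW E k u v ≡ true → reachW E (d + k) u v ≡ true
    R-up* zero k u v r = r
    R-up* (suc d) k u v r = R-up (d + k) u v (R-up* d k u v r)

    R-mono : ∀ k m u v → k ≤ m → reachW E k u v ≡ true → reachW E m u v ≡ true
    R-mono k m u v k≤m r = subst (λ z → reachW E z u v ≡ true) (NP.m∸n+n≡m k≤m) (R-up* (m ℕ.∸ k) k u v r)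

    R-adj : ∀ u v → adj E u v ≡ true → reachW E 1 u v ≡ true
    R-adj u v a = R-step 0 u u v (==-refl u) a

    R-cat : ∀ j k u v x → reachW E j u v ≡ true → reachW E k v x ≡ true → reachW E (k + j) u x ≡ true
    R-cat j zero u v x r q = subst (λ z → reachW E j u z ≡ true) (==-sound q) r
    R-cat j (suc k) u v x r q with ∨-el {reachW E k v x} q
    ... | inj₁ q' = R-up (k + j) u x (R-cat j k u v x r q')
    ... | inj₂ q' with any-el _ (allFin n) q'
    ... | y , _ , ya = R-step (k + j) u y x (R-cat j k u v y r (∧-l {reachW E k v y} ya)) (∧-r {reachW E k v y} ya)

    adj-sym : ∀ u v → adj E u v ≡ adj E v u
    adj-sym u v = any-cong _ _ E (λ e _ → BP.∨-comm ((proj₁ e == u) ∧ (proj₂ e == v)) ((proj₁ e == v) ∧ (proj₂ e == u)))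

    R-sym : ∀ k u v → reachW E k u v ≡ true → reachW E k v u ≡ true
    R-sym zero u v r = trans (==-sym v u) r
    R-sym (suc k) u v r with ∨-el {reachW E k u v} r
    ... | inj₁ r' = R-up k v u (R-sym k u v r')
    ... | inj₂ r' with any-el _ (allFin n) r'
    ... | y , _ , ya = subst (λ z → reachW E z v u ≡ true) (NP.+-comm k 1)
                        (R-cat 1 k v y u (R-adj v y (trans (adj-sym v y) (∧-r {reachW E k u y} ya))) (R-sym k u y (∧-l {reachW E k u y} ya)))

    pathToR : ∀ u xs → pathAdj E (u ∷ xs) ≡ true → reachW E (length xs) u (last u xs) ≡ true
    pathToR u [] p = ==-refl u
    pathToR u (x ∷ xs) p = subst (λ z → reachW E z u (last x xs) ≡ true) (NP.+-comm (length xs) 1)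
                             (R-cat 1 (length xs) u x (last x xs) (R-adj u x (path-hd E u x xs p)) (pathToR x xs (path-tl E u x xs p)))

    path-snoc : ∀ u xs v → pathAdj E (u ∷ xs) ≡ true → adj E (last u xs) v ≡ true → pathAdj E (u ∷ (xs ++ v ∷ [])) ≡ true
    path-snoc u [] v p a = ∧-in a refl
    path-snoc u (x ∷ xs) v p a = path-cons {E = E} {x = u} {y = x} {xs = xs ++ v ∷ []} (path-hd E u x xs p) (path-snoc x xs v (path-tl E u x xs p) a)

  last-snoc : ∀ {A : Set} (u : A) xs v → last u (xs ++ v ∷ []) ≡ v
  last-snoc u [] v = refl
  last-snoc u (x ∷ xs) v = last-snoc x xs v

  module _ {n : ℕ} where

    elemF-++ : ∀ (y : Fin n) xs ys → elemF y (xs ++ ys) ≡ (elemF y xs ∨ elemF y ys)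
    elemF-++ y xs ys = any-++ (_== y) xs ys

    distinct-snoc : ∀ (ys : List (Fin n)) v → distinct ys ≡ true → elemF v ys ≡ false → distinct (ys ++ v ∷ []) ≡ true
    distinct-snoc [] v d e = refl
    distinct-snoc (y ∷ ys) v d e = dist-cons {x = y} {xs = ys ++ v ∷ []} nm (distinct-snoc ys v (dist-tl y ys d) (proj₂ (∨-f {y == v} e)))
      where
      nm : elemF y (ys ++ v ∷ []) ≡ false
      nm = trans (elemF-++ y ys (v ∷ [])) (cong₂ _∨_ (dist-hd y ys d) (trans (BP.∨-identityʳ (v == y)) (trans (==-sym v y) (proj₁ (∨-f {y == v} e)))))

    trunc : Fin n → Fin n → List (Fin n) → List (Fin n)
    trunc v u [] = []
    trunc v u (x ∷ xs) = if u == v then [] else x ∷ trunc v x xs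

    tr-last : ∀ v u xs → elemF v (u ∷ xs) ≡ true → last u (trunc v u xs) ≡ v
    tr-last v u [] e with u == v in eq
    ... | true = ==-sound eq
    tr-last v u (x ∷ xs) e with u == v in eq
    ... | true = ==-sound eq
    ... | false = tr-last v x xs e

    tr-path : ∀ {E : Graph n} v u xs → pathAdj E (u ∷ xs) ≡ true → pathAdj E (u ∷ trunc v u xs) ≡ true
    tr-path v u [] p = refl
    tr-path v u (x ∷ xs) p with u == v
    ... | true = refl
    ... | false = path-cons {x = u} {y = x} {xs = trunc v x xs} (path-hd _ u x xs p) (tr-path v x xs (path-tl _ u x xs p))

    tr-sub : ∀ y v u xs → elemF y (trunc v u xs) ≡ true → elemF y xs ≡ true
    tr-sub y v u (x ∷ xs) e with u == v
    ... | false with ∨-el {x == y} e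
    ... | inj₁ q = ∨-l _ q
    ... | inj₂ q = ∨-r (x == y) (tr-sub y v x xs q)

    tr-dist : ∀ v u xs → distinct (u ∷ xs) ≡ true → distinct (u ∷ trunc v u xs) ≡ true
    tr-dist v u [] d = d
    tr-dist v u (x ∷ xs) d with u == v
    ... | true = refl
    ... | false = dist-cons {x = u} {xs = x ∷ trunc v x xs} nu (tr-dist v x xs (dist-tl u (x ∷ xs) d))
      where
      nu : elemF u (x ∷ trunc v x xs) ≡ false
      nu with elemF u (x ∷ trunc v x xs) in eq
      ... | false = refl
      ... | true with ∨-el {x == u} eq
      ... | inj₁ q = ⊥-elim (true≢false (∨-l (elemF u xs) q) (dist-hd u (x ∷ xs) d))
      ... | inj₂ q = ⊥-elim (true≢false (∨-r (x == u) (tr-sub u v x xs q)) (dist-hd u (x ∷ xs) d))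

    lookup-inj : ∀ (xs : List (Fin n)) → distinct xs ≡ true → ∀ i j → lookup xs i ≡ lookup xs j → i ≡ j
    lookup-inj (x ∷ xs) d Fin.zero Fin.zero q = refl
    lookup-inj (x ∷ xs) d Fin.zero (Fin.suc j) q = ⊥-elim (true≢false (elemF-in (subst (_∈ xs) (sym q) (∈-lookup j))) (dist-hd x xs d))
    lookup-inj (x ∷ xs) d (Fin.suc i) Fin.zero q = ⊥-elim (true≢false (elemF-in (subst (_∈ xs) q (∈-lookup i))) (dist-hd x xs d))
    lookup-inj (x ∷ xs) d (Fin.suc i) (Fin.suc j) q = cong Fin.suc (lookup-inj xs (dist-tl x xs d) i j q)

    distinct-len : ∀ (xs : List (Fin n)) → distinct xs ≡ true → length xs ≤ n
    distinct-len xs d with length xs ℕ.≤? n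
    ... | yes p = p
    ... | no ¬p with FinP.pigeonhole (NP.≰⇒> ¬p) (lookup xs)
    ... | i , j , i<j , q = ⊥-elim (NP.<-irrefl (cong toℕ (lookup-inj xs d i j q)) i<j)

  module _ {n : ℕ} {E : Graph n} where

    RtoP : ∀ k u v → reachW E k u v ≡ true → Σ (List (Fin n)) λ xs → (pathAdj E (u ∷ xs) ≡ true) × (last u xs ≡ v) × (distinct (u ∷ xs) ≡ true)
    RtoP zero u v r = [] , refl , ==-sound r , refl
    RtoP (suc k) u v r with ∨-el {reachW E k u v} r
    ... | inj₁ r' = RtoP k u v r'
    ... | inj₂ r' with any-el _ (allFin n) r'
    ... | y , _ , ya with RtoP k u y (∧-l {reachW E k u y} ya)
    ... | xs , p , l , d with elemF v (u ∷ xs) in ev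
    ... | true = trunc v u xs , tr-path v u xs p , tr-last v u xs ev , tr-dist v u xs d
    ... | false = xs ++ v ∷ [] , path-snoc u xs v p (subst (λ z → adj E z v ≡ true) (sym l) (∧-r {reachW E k u y} ya)) , last-snoc u xs v , distinct-snoc (u ∷ xs) v d ev

    R-short : ∀ k {u v} → reachW E k u v ≡ true → reachW E n u v ≡ true
    R-short k {u} {v} r with RtoP k u v r
    ... | xs , p , l , d = R-mono (length xs) n u v (NP.<⇒≤ (distinct-len (u ∷ xs) d)) (subst (λ z → reachW E (length xs) u z ≡ true) l (pathToR u xs p))

    conn-refl : ∀ u → connected E u u ≡ true
    conn-refl u = R-short 0 {u} {u} (==-refl u)

    conn-sym : ∀ {u v} → connected E u v ≡ true → connected E v u ≡ true
    conn-sym {u} {v} r = R-sym {E = E} n u v r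

    conn-trans : ∀ {u v x} → connected E u v ≡ true → connected E v x ≡ true → connected E u x ≡ true
    conn-trans {u} {v} {x} r q = R-short (n + n) {u} {x} (R-cat {E = E} n n u v x r q)

    conn-adj : ∀ {u v} → adj E u v ≡ true → connected E u v ≡ true
    conn-adj {u} {v} a = R-short 1 {u} {v} (R-adj {E = E} u v a)

    conn-step : ∀ {u x v} → connected E u x ≡ true → adj E x v ≡ true → connected E u v ≡ true
    conn-step {u} {x} {v} r a = conn-trans {u} {x} {v} r (conn-adj {x} {v} a)

    path-conn : ∀ u xs → pathAdj E (u ∷ xs) ≡ true → connected E u (last u xs) ≡ true
    path-conn u xs p = R-short (length xs) {u} {last u xs} (pathToR u xs p)

module Cycles where

  open import Defs
  open Basics
  open Walks
  open import Data.Bool using (Bool; true; false; _∧_; _∨_)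
  open import Data.Nat using (ℕ; suc; _≤_; _<_; s≤s; _+_; _<ᵇ_)
  open import Data.Fin using (Fin)
  open import Data.List using (List; []; _∷_; length; _++_; upTo)
  open import Data.Bool.ListAction using (any)
  open import Data.Product using (_×_; _,_; proj₁; proj₂; Σ)
  open import Data.Sum using (_⊎_; inj₁; inj₂)
  open import Data.Empty using (⊥; ⊥-elim)
  open import Relation.Nullary using (¬_)
  open import Relation.Binary.PropositionalEquality
  open import Data.List.Membership.Propositional using (_∈_)
  open import Data.List.Membership.Propositional.Properties using (∈-upTo⁺; ∈-++⁺ʳ)
  open import Data.List.Relation.Unary.Any using (here; there)

  eAdj : ∀ {n} → Edge n → Fin n → Fin n → Bool
  eAdj e u v = ((proj₁ e == u) ∧ (proj₂ e == v)) ∨ ((proj₁ e == v) ∧ (proj₂ e == u))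

  eAdj-el : ∀ {n} (a b u v : Fin n) → eAdj (a , b) u v ≡ true → (u ≡ a × v ≡ b) ⊎ (u ≡ b × v ≡ a)
  eAdj-el a b u v p with ∨-el {(a == u) ∧ (b == v)} p
  ... | inj₁ q = inj₁ (sym (==-sound (∧-l {a == u} q)) , sym (==-sound (∧-r {a == u} q)))
  ... | inj₂ q = inj₂ (sym (==-sound (∧-r {a == v} q)) , sym (==-sound (∧-l {a == v} q)))

  eAdj-ba : ∀ {n} (a b : Fin n) → eAdj (a , b) b a ≡ true
  eAdj-ba a b = ∨-r ((a == b) ∧ (b == a)) (∧-in (==-refl a) (==-refl b))

  module _ {n : ℕ} where

    adj-mono : ∀ (e : Edge n) G u v → adj G u v ≡ true → adj (e ∷ G) u v ≡ true
    adj-mono e G u v a = ∨-r (eAdj e u v) a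

    path-mono : ∀ (e : Edge n) G xs → pathAdj G xs ≡ true → pathAdj (e ∷ G) xs ≡ true
    path-mono e G [] p = refl
    path-mono e G (x ∷ []) p = refl
    path-mono e G (x ∷ y ∷ xs) p = path-cons {E = e ∷ G} {x} {y} {xs} (adj-mono e G x y (path-hd G x y xs p)) (path-mono e G (y ∷ xs) (path-tl G x y xs p))

    cyc-el : ∀ (E : Graph n) v vs → isCycle E (v ∷ vs) ≡ true →
      ((2 <ᵇ length (v ∷ vs)) ≡ true) × (distinct (v ∷ vs) ≡ true) × (pathAdj E (v ∷ vs) ≡ true) × (adj E (last v vs) v ≡ true)
    cyc-el E v vs p = ∧-l {2 <ᵇ length (v ∷ vs)} p , ∧-l {distinct (v ∷ vs)} p2 , ∧-l {pathAdj E (v ∷ vs)} p3 , ∧-r {pathAdj E (v ∷ vs)} p3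
      where
      p2 = ∧-r {2 <ᵇ length (v ∷ vs)} p
      p3 = ∧-r {distinct (v ∷ vs)} p2

    cyc-in : ∀ (E : Graph n) v vs → (2 <ᵇ length (v ∷ vs)) ≡ true → distinct (v ∷ vs) ≡ true → pathAdj E (v ∷ vs) ≡ true → adj E (last v vs) v ≡ true → isCycle E (v ∷ vs) ≡ true
    cyc-in E v vs a b c d = ∧-in a (∧-in b (∧-in c d))

    cyc-mono : ∀ (e : Edge n) G c → isCycle G c ≡ true → isCycle (e ∷ G) c ≡ true
    cyc-mono e G (v ∷ vs) p with cyc-el G v vs p
    ... | l , d , q , a = cyc-in (e ∷ G) v vs l d (path-mono e G (v ∷ vs) q) (adj-mono e G _ _ a)

    hasCycle-mono : ∀ (e : Edge n) G → hasCycle G ≡ true → hasCycle (e ∷ G) ≡ true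
    hasCycle-mono e G h = any-mono _ _ (upTo (suc n)) (λ k p → any-mono (isCycle G) (isCycle (e ∷ G)) (vlists n k) (cyc-mono e G) p) h

    -- 'hasCycle' decides the existence of a cycle (distinct cycles have
    -- length ≤ n, so the bounded search finds them).
    hasCycle-in : ∀ (E : Graph n) c → isCycle E c ≡ true → distinct c ≡ true → hasCycle E ≡ true
    hasCycle-in E c p d = any-in (λ k → any (isCycle E) (vlists n k)) (∈-upTo⁺ (s≤s (distinct-len c d))) (any-in (isCycle E) (∈-vlists c) p)

    hasCycle-el : ∀ (E : Graph n) → hasCycle E ≡ true → Σ (List (Fin n)) λ c → (isCycle E c ≡ true) × (∀ (E' : Graph n) → isCycle E' c ≡ true → hasCycle E' ≡ true)
    hasCycle-el E h with any-el _ (upTo (suc n)) h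
    ... | k , mk , q with any-el _ (vlists n k) q
    ... | c , mc , r = c , r , λ E' r' → any-in (λ k → any (isCycle E') (vlists n k)) mk (any-in (isCycle E') mc r')

  last-mem : ∀ {A : Set} (z : A) zs → last z zs ∈ z ∷ zs
  last-mem z [] = here refl
  last-mem z (w ∷ ws) = there (last-mem w ws)

  last-split : ∀ {A : Set} (u : A) xs ys w ws → u ∷ xs ≡ ys ++ w ∷ ws → last u xs ≡ last w ws
  last-split u xs [] w ws refl = refl
  last-split u [] (y ∷ []) w ws ()
  last-split u [] (y ∷ y' ∷ ys) w ws ()
  last-split u (x ∷ xs) (y ∷ ys) w ws eq = last-split x xs ys w ws (LP.∷-injectiveʳ eq)
    where import Data.List.Properties as LP

  module _ {n : ℕ} where
    open import Data.List.Properties as LP using (∷-injectiveˡ; ∷-injectiveʳ)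

    -- A simple path of G from a to b plus the new edge (a , b) is a cycle.
    cyc-from-conn : ∀ (G : Graph n) a b → ¬ a ≡ b → adj G a b ≡ false → connected G a b ≡ true → hasCycle ((a , b) ∷ G) ≡ true
    cyc-from-conn G a b a≢b nadj r with RtoP {E = G} n a b r
    ... | [] , p , l , d = ⊥-elim (a≢b l)
    ... | x ∷ [] , p , refl , d = ⊥-elim (true≢false (path-hd G a x [] p) nadj)
    ... | x ∷ y ∷ ys , p , l , d = hasCycle-in ((a , b) ∷ G) (a ∷ x ∷ y ∷ ys)
          (cyc-in ((a , b) ∷ G) a (x ∷ y ∷ ys) refl d (path-mono (a , b) G (a ∷ x ∷ y ∷ ys) p)
            (subst (λ z → adj ((a , b) ∷ G) z a ≡ true) (sym l) (∨-l (adj G b a) (eAdj-ba a b)))) d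

    UsesEdge : Fin n → Fin n → Graph n → List (Fin n) → Set
    UsesEdge a b G c = Σ (List (Fin n)) λ ys → Σ (Fin n) λ s → Σ (Fin n) λ t → Σ (List (Fin n)) λ zs →
      (c ≡ ys ++ s ∷ t ∷ zs) × (eAdj (a , b) s t ≡ true) × (pathAdj G (ys ++ s ∷ []) ≡ true) × (pathAdj G (t ∷ zs) ≡ true)

    st-mem : ∀ (a b s t u : Fin n) → eAdj (a , b) s t ≡ true → (u ≡ a ⊎ u ≡ b) → u ≡ s ⊎ u ≡ t
    st-mem a b s t u est h with eAdj-el a b s t est | h
    ... | inj₁ (refl , refl) | inj₁ refl = inj₁ refl
    ... | inj₁ (refl , refl) | inj₂ refl = inj₂ refl
    ... | inj₂ (refl , refl) | inj₁ refl = inj₂ refl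
    ... | inj₂ (refl , refl) | inj₂ refl = inj₁ refl

    ab-of : ∀ (a b u v : Fin n) → eAdj (a , b) u v ≡ true → u ≡ a ⊎ u ≡ b
    ab-of a b u v e with eAdj-el a b u v e
    ... | inj₁ (p , _) = inj₁ p
    ... | inj₂ (p , _) = inj₂ p

    ab-of' : ∀ (a b u v : Fin n) → eAdj (a , b) u v ≡ true → v ≡ a ⊎ v ≡ b
    ab-of' a b u v e with eAdj-el a b u v e
    ... | inj₁ (_ , p) = inj₂ p
    ... | inj₂ (_ , p) = inj₁ p

    pathThroughEdge : ∀ (a b : Fin n) G u xs → pathAdj ((a , b) ∷ G) (u ∷ xs) ≡ true → distinct (u ∷ xs) ≡ true →
        pathAdj G (u ∷ xs) ≡ true ⊎ UsesEdge a b G (u ∷ xs)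
    pathThroughEdge a b G u [] p d = inj₁ refl
    pathThroughEdge a b G u (x ∷ xs) p d with ∨-el {eAdj (a , b) u x} (path-hd ((a , b) ∷ G) u x xs p) | pathThroughEdge a b G x xs (path-tl ((a , b) ∷ G) u x xs p) (dist-tl u (x ∷ xs) d)
    ... | inj₁ ea | inj₁ q = inj₂ ([] , u , x , xs , refl , ea , refl , q)
    ... | inj₁ ea | inj₂ (ys , s , t , zs , eq , est , _ , _) = ⊥-elim (true≢false (elemF-in mem) (dist-hd u (x ∷ xs) d))
      where
      mem : u ∈ x ∷ xs
      mem with st-mem a b s t u est (ab-of a b u x ea)
      ... | inj₁ refl = subst (u ∈_) (sym eq) (∈-++⁺ʳ ys (here refl))
      ... | inj₂ refl = subst (u ∈_) (sym eq) (∈-++⁺ʳ ys (there (here refl)))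
    ... | inj₂ ga | inj₁ q = inj₁ (path-cons {E = G} {u} {x} {xs} ga q)
    ... | inj₂ ga | inj₂ (ys , s , t , zs , eq , est , q1 , q2) = inj₂ (u ∷ ys , s , t , zs , cong (u ∷_) eq , est , q1' ys eq q1 , q2)
      where
      q1' : ∀ ys → x ∷ xs ≡ ys ++ s ∷ t ∷ zs → pathAdj G (ys ++ s ∷ []) ≡ true → pathAdj G (u ∷ (ys ++ s ∷ [])) ≡ true
      q1' [] e q = path-cons {E = G} {u} {s} {[]} (subst (λ z → adj G u z ≡ true) (∷-injectiveˡ e) ga) q
      q1' (y ∷ ys') e q = path-cons {E = G} {u} {y} {ys' ++ s ∷ []} (subst (λ z → adj G u z ≡ true) (∷-injectiveˡ e) ga) q

    conn-ab : ∀ (G : Graph n) a b s t → eAdj (a , b) s t ≡ true → connected G s t ≡ true → connected G a b ≡ true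
    conn-ab G a b s t est r with eAdj-el a b s t est
    ... | inj₁ (refl , refl) = r
    ... | inj₂ (refl , refl) = conn-sym {E = G} {s} {t} r

    cyc-contra : ∀ (a b : Fin n) → ¬ a ≡ b → ∀ v vs ys s t zs → distinct (v ∷ vs) ≡ true → (2 <ᵇ length (v ∷ vs)) ≡ true →
       v ∷ vs ≡ ys ++ s ∷ t ∷ zs → eAdj (a , b) s t ≡ true → eAdj (a , b) (last v vs) v ≡ true → ⊥
    cyc-contra a b a≢b v vs (y ∷ ys') s t zs d len eq est ea =
      true≢false (elemF-in mem) (dist-hd v vs d)
      where
      eqvs : vs ≡ ys' ++ s ∷ t ∷ zs
      eqvs = ∷-injectiveʳ eq
      mem : v ∈ vs
      mem with st-mem a b s t v est (ab-of' a b (last v vs) v ea)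
      ... | inj₁ refl = subst (v ∈_) (sym eqvs) (∈-++⁺ʳ ys' (here refl))
      ... | inj₂ refl = subst (v ∈_) (sym eqvs) (∈-++⁺ʳ ys' (there (here refl)))
    cyc-contra a b a≢b v vs [] s t zs d len eq est ea with ∷-injectiveˡ eq | ∷-injectiveʳ eq
    ... | refl | refl = lt (eAdj-el a b (last t zs) v ea) (eAdj-el a b v t est)
      where
      key : ∀ zs → distinct (v ∷ t ∷ zs) ≡ true → (2 <ᵇ length (v ∷ t ∷ zs)) ≡ true → last t zs ≡ t → ⊥
      key [] d () e
      key (z ∷ zs') d len e = true≢false (elemF-in (subst (_∈ z ∷ zs') e (last-mem z zs'))) (dist-hd t (z ∷ zs') (dist-tl v (t ∷ z ∷ zs') d))
      lt : (last t zs ≡ a × v ≡ b) ⊎ (last t zs ≡ b × v ≡ a) → (v ≡ a × t ≡ b) ⊎ (v ≡ b × t ≡ a) → ⊥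
      lt (inj₁ (la , vb)) (inj₁ (va , tb)) = a≢b (trans (sym va) vb)
      lt (inj₁ (la , vb)) (inj₂ (vb' , ta)) = key zs d len (trans la (sym ta))
      lt (inj₂ (lb , va)) (inj₁ (va' , tb)) = key zs d len (trans lb (sym tb))
      lt (inj₂ (lb , va)) (inj₂ (vb , ta)) = a≢b (trans (sym va) vb)

    conn-prefix : ∀ (G : Graph n) v vs ys s t zs → v ∷ vs ≡ ys ++ s ∷ t ∷ zs → pathAdj G (ys ++ s ∷ []) ≡ true → connected G v s ≡ true
    conn-prefix G v vs [] s t zs eq q rewrite ∷-injectiveˡ eq = conn-refl {E = G} s
    conn-prefix G v vs (y ∷ ys') s t zs eq q rewrite ∷-injectiveˡ eq =
      subst (λ z → connected G y z ≡ true) (last-snoc y ys' s) (path-conn {E = G} y (ys' ++ s ∷ []) q)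

    hasCycle-ext : ∀ (G : Graph n) a b → ¬ a ≡ b → hasCycle ((a , b) ∷ G) ≡ true → hasCycle G ≡ true ⊎ connected G a b ≡ true
    hasCycle-ext G a b a≢b h with hasCycle-el ((a , b) ∷ G) h
    ... | [] , () , tr
    ... | v ∷ vs , r , tr with cyc-el ((a , b) ∷ G) v vs r
    ... | len , d , p , cl with pathThroughEdge a b G v vs p d | ∨-el {eAdj (a , b) (last v vs) v} cl
    ... | inj₁ q | inj₂ g = inj₁ (tr G (cyc-in G v vs len d q g))
    ... | inj₁ q | inj₁ ea = inj₂ (conn-ab G a b v (last v vs) (swap (eAdj-el a b (last v vs) v ea)) (path-conn {E = G} v vs q))
      where
      swap : ((last v vs) ≡ a × v ≡ b) ⊎ ((last v vs) ≡ b × v ≡ a) → eAdj (a , b) v (last v vs) ≡ true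
      swap (inj₁ (refl , refl)) = eAdj-ba a b
      swap (inj₂ (refl , refl)) = ∨-l _ (∧-in (==-refl a) (==-refl b))
    ... | inj₂ (ys , s , t , zs , eq , est , q1 , q2) | inj₁ ea = ⊥-elim (cyc-contra a b a≢b v vs ys s t zs d len eq est ea)
    ... | inj₂ (ys , s , t , zs , eq , est , q1 , q2) | inj₂ g =
      inj₂ (conn-ab G a b s t est (conn-sym {E = G} {t} {s} ts))
      where
      tl : connected G t (last t zs) ≡ true
      tl = path-conn {E = G} t zs q2
      tv : connected G t v ≡ true
      tv = conn-step {E = G} {t} {last t zs} {v} tl (subst (λ z → adj G z v ≡ true) (last-split v vs (ys ++ s ∷ []) t zs (trans eq (sym (LP.++-assoc ys (s ∷ []) (t ∷ zs))))) g)
      ts : connected G t s ≡ true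
      ts = conn-trans {E = G} {t} {v} {s} tv (conn-prefix G v vs ys s t zs eq q1)

-- Every vertex is
-- connected to exactly one representative, which gives the two
-- characterisations used later:
--   components E ≡ 1  ⇔  all vertices are connected,
--   components E ≡ 2  ⇔  some non-connected a, b have every vertex connected
--                          to a or to b.
module Components where

  open import Defs
  open Basics
  open Walks
  open import Data.Bool using (Bool; true; false; _∧_; _∨_; not; if_then_else_; T)
  open import Data.Bool.Properties as BP using ()
  open import Data.Nat using (ℕ; suc; _≤_; _<_; z≤n; s≤s; _+_; _<ᵇ_; _≡ᵇ_)
  open import Data.Nat.Properties as NP using ()
  open import Data.Fin as Fin using (Fin; toℕ)
  open import Data.Fin.Properties as FinP using ()
  open import Data.List using ([]; _∷_; map; allFin)
  open import Data.List.Properties as LP using ()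
  open import Data.Bool.ListAction using (any)
  open import Data.Product using (_×_; _,_; proj₁; proj₂; Σ)
  open import Data.Sum using (_⊎_; inj₁; inj₂)
  open import Data.Empty using (⊥; ⊥-elim)
  open import Data.Unit using (tt)
  open import Relation.Nullary using (¬_)
  open import Relation.Binary using (tri<; tri≈; tri>)
  open import Relation.Binary.PropositionalEquality
  open import Data.List.Membership.Propositional using (_∈_)
  open import Data.List.Membership.Propositional.Properties using (∈-allFin)

  T⇒≡ : ∀ {b} → T b → b ≡ true
  T⇒≡ {true} _ = refl

  ≡⇒T : ∀ {b} → b ≡ true → T b
  ≡⇒T refl = tt

  bool-ext : ∀ {p q : Bool} → (p ≡ true → q ≡ true) → (q ≡ true → p ≡ true) → p ≡ q
  bool-ext {true} f g = sym (f refl)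
  bool-ext {false} {true} f g = g refl
  bool-ext {false} {false} f g = refl

  <F-sound : ∀ {n} (u v : Fin n) → (u <F v) ≡ true → toℕ u < toℕ v
  <F-sound u v p = NP.<ᵇ⇒< (toℕ u) (toℕ v) (≡⇒T p)

  <F-in : ∀ {n} (u v : Fin n) → toℕ u < toℕ v → (u <F v) ≡ true
  <F-in u v p = T⇒≡ (NP.<⇒<ᵇ p)

  count-cong : ∀ {A : Set} (p q : A → Bool) xs → (∀ x → p x ≡ q x) → count p xs ≡ count q xs
  count-cong p q [] h = refl
  count-cong p q (x ∷ xs) h with p x | q x | h x
  ... | true | true | _ = cong suc (count-cong p q xs h)
  ... | false | false | _ = count-cong p q xs h

  count-mono : ∀ {A : Set} (p q : A → Bool) xs → (∀ x → q x ≡ true → p x ≡ true) → count q xs ≤ count p xs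
  count-mono p q [] h = z≤n
  count-mono p q (x ∷ xs) h with q x in eq
  ... | true rewrite h x eq = s≤s (count-mono p q xs h)
  ... | false with p x
  ... | true = NP.m≤n⇒m≤1+n (count-mono p q xs h)
  ... | false = count-mono p q xs h

  count-∨ : ∀ {A : Set} (p q : A → Bool) xs → (∀ x → p x ∧ q x ≡ false) → count (λ x → p x ∨ q x) xs ≡ count p xs + count q xs
  count-∨ p q [] h = refl
  count-∨ p q (x ∷ xs) h with p x | q x | h x
  ... | true | false | _ = cong suc (count-∨ p q xs h)
  ... | false | true | _ = trans (cong suc (count-∨ p q xs h)) (sym (NP.+-suc _ _))
  ... | false | false | _ = count-∨ p q xs h

  count-map : ∀ {A B : Set} (p : B → Bool) (f : A → B) xs → count p (map f xs) ≡ count (λ x → p (f x)) xs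
  count-map p f [] = refl
  count-map p f (x ∷ xs) with p (f x)
  ... | true = cong suc (count-map p f xs)
  ... | false = count-map p f xs

  count-false : ∀ {A : Set} (p : A → Bool) xs → (∀ x → p x ≡ false) → count p xs ≡ 0
  count-false p [] h = refl
  count-false p (x ∷ xs) h rewrite h x = count-false p xs h

  suc==suc : ∀ {n} (u v : Fin n) → (Fin.suc u == Fin.suc v) ≡ (u == v)
  suc==suc u v = bool-ext (λ p → subst (λ z → (u == z) ≡ true) (FinP.suc-injective (==-sound p)) (==-refl u))
                          (λ p → subst (λ z → (Fin.suc u == Fin.suc z) ≡ true) (==-sound p) (==-refl (Fin.suc u)))

  allFin-suc : ∀ n → allFin (suc n) ≡ Fin.zero ∷ map Fin.suc (allFin n)
  allFin-suc n = cong (Fin.zero ∷_) (sym (LP.map-tabulate (λ i → i) Fin.suc))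

  count-cons : ∀ {A : Set} (p : A → Bool) y ys → count p (y ∷ ys) ≡ (if p y then suc (count p ys) else count p ys)
  count-cons p y ys with p y
  ... | true = refl
  ... | false = refl

  count-eq1 : ∀ n (x : Fin n) → count (λ v → v == x) (allFin n) ≡ 1
  count-eq1 (suc n) x = trans (cong (count (λ v → v == x)) (allFin-suc n)) (trans (count-cons (λ v → v == x) Fin.zero _) (h x))
    where
    h : ∀ x → (if Fin.zero == x then suc (count (λ v → v == x) (map Fin.suc (allFin n))) else count (λ v → v == x) (map Fin.suc (allFin n))) ≡ 1
    h Fin.zero = cong suc (trans (count-map _ Fin.suc (allFin n)) (count-false _ (allFin n) (λ v → ==-false {u = Fin.suc v} {v = Fin.zero} (λ ()))))
    h (Fin.suc x') = trans (count-map _ Fin.suc (allFin n)) (trans (count-cong _ (λ v → v == x') (allFin n) (λ v → suc==suc v x')) (count-eq1 n x'))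

  count-eq2 : ∀ n (x y : Fin n) → ¬ x ≡ y → count (λ v → (v == x) ∨ (v == y)) (allFin n) ≡ 2
  count-eq2 n x y x≢y = trans (count-∨ _ _ (allFin n) disj) (cong₂ _+_ (count-eq1 n x) (count-eq1 n y))
    where
    disj : ∀ v → (v == x) ∧ (v == y) ≡ false
    disj v with v == x in e1 | v == y in e2
    ... | true | true = ⊥-elim (x≢y (trans (sym (==-sound e1)) (==-sound e2)))
    ... | true | false = refl
    ... | false | _ = refl

  count-eq3 : ∀ n (x y z : Fin n) → ¬ x ≡ y → ¬ x ≡ z → ¬ y ≡ z → count (λ v → ((v == x) ∨ (v == y)) ∨ (v == z)) (allFin n) ≡ 3
  count-eq3 n x y z xy xz yz = trans (count-∨ _ _ (allFin n) disj) (cong₂ _+_ (count-eq2 n x y xy) (count-eq1 n z))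
    where
    disj : ∀ v → ((v == x) ∨ (v == y)) ∧ (v == z) ≡ false
    disj v with v == x in e1 | v == y in e2 | v == z in e3
    ... | _ | _ | false = BP.∧-zeroʳ _
    ... | true | _ | true = ⊥-elim (xz (trans (sym (==-sound e1)) (==-sound e3)))
    ... | false | true | true = ⊥-elim (yz (trans (sym (==-sound e2)) (==-sound e3)))
    ... | false | false | true = refl

  isRep : ∀ {n} → Graph n → Fin n → Bool
  isRep {n} E v = not (any (λ u → (u <F v) ∧ connected E v u) (allFin n))

  module _ {n : ℕ} (E : Graph n) where

    rep-not : ∀ v u → toℕ u < toℕ v → connected E v u ≡ true → isRep E v ≡ false
    rep-not v u lt c with any (λ u → (u <F v) ∧ connected E v u) (allFin n) in eq
    ... | true = refl
    ... | false = ⊥-elim (true≢false (any-in (λ u → (u <F v) ∧ connected E v u) (∈-allFin u) (∧-in (<F-in u v lt) c)) eq)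

    rep-ex' : ∀ k v → toℕ v < k → Σ (Fin n) λ r → (connected E v r ≡ true) × (isRep E r ≡ true)
    rep-ex' (suc k) v lt with any (λ u → (u <F v) ∧ connected E v u) (allFin n) in eq
    ... | false = v , conn-refl {E = E} v , not-f eq
    ... | true with any-el (λ u → (u <F v) ∧ connected E v u) (allFin n) eq
    ... | u , _ , q with rep-ex' k u (NP.<-≤-trans (<F-sound u v (∧-l {u <F v} q)) (NP.≤-pred lt))
    ... | r , c , rr = r , conn-trans {E = E} {v} {u} {r} (∧-r {u <F v} q) c , rr

    rep-ex : ∀ v → Σ (Fin n) λ r → (connected E v r ≡ true) × (isRep E r ≡ true)
    rep-ex v = rep-ex' (suc (toℕ v)) v (NP.n<1+n (toℕ v))

    rep-uniq : ∀ r r' → isRep E r ≡ true → isRep E r' ≡ true → connected E r r' ≡ true → r ≡ r'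
    rep-uniq r r' p p' c with NP.<-cmp (toℕ r) (toℕ r')
    ... | tri< lt _ _ = ⊥-elim (true≢false p' (rep-not r' r lt (conn-sym {E = E} {r} {r'} c)))
    ... | tri≈ _ eq _ = FinP.toℕ-injective eq
    ... | tri> _ _ gt = ⊥-elim (true≢false p (rep-not r r' gt c))

    private
      ct = λ {x} {y} {z} → conn-trans {E = E} {x} {y} {z}
      cs = λ {x} {y} → conn-sym {E = E} {x} {y}

    -- Non-connected vertices have different representatives, so they give
    -- lower bounds on the number of components.
    rep-neq : ∀ a v → connected E a v ≡ false → proj₁ (rep-ex a) ≡ proj₁ (rep-ex v) → ⊥
    rep-neq a v nc eq with rep-ex a | rep-ex v
    ... | ra , ca , _ | rv , cv , _ = true≢false (ct {a} {ra} {v} ca (cs {v} {ra} (subst (λ z → connected E v z ≡ true) (sym eq) cv))) nc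

    comps-ge2 : ∀ a v → connected E a v ≡ false → 2 ≤ components E
    comps-ge2 a v nc = subst (_≤ components E) (count-eq2 n ra rv (rep-neq a v nc))
       (count-mono (isRep E) (λ x → (x == ra) ∨ (x == rv)) (allFin n) h)
      where
      ra = proj₁ (rep-ex a)
      rv = proj₁ (rep-ex v)
      h : ∀ x → (x == ra) ∨ (x == rv) ≡ true → isRep E x ≡ true
      h x p with ∨-el {x == ra} p
      ... | inj₁ q = subst (λ z → isRep E z ≡ true) (sym (==-sound q)) (proj₂ (proj₂ (rep-ex a)))
      ... | inj₂ q = subst (λ z → isRep E z ≡ true) (sym (==-sound q)) (proj₂ (proj₂ (rep-ex v)))

    comps-ge3 : ∀ a b v → connected E a b ≡ false → connected E a v ≡ false → connected E b v ≡ false → 3 ≤ components E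
    comps-ge3 a b v nab nav nbv = subst (_≤ components E) (count-eq3 n ra rb rv (rep-neq a b nab) (rep-neq a v nav) (rep-neq b v nbv))
       (count-mono (isRep E) (λ x → ((x == ra) ∨ (x == rb)) ∨ (x == rv)) (allFin n) h)
      where
      ra = proj₁ (rep-ex a)
      rb = proj₁ (rep-ex b)
      rv = proj₁ (rep-ex v)
      h : ∀ x → ((x == ra) ∨ (x == rb)) ∨ (x == rv) ≡ true → isRep E x ≡ true
      h x p with ∨-el {(x == ra) ∨ (x == rb)} p
      ... | inj₂ q = subst (λ z → isRep E z ≡ true) (sym (==-sound q)) (proj₂ (proj₂ (rep-ex v)))
      ... | inj₁ p' with ∨-el {x == ra} p'
      ... | inj₁ q = subst (λ z → isRep E z ≡ true) (sym (==-sound q)) (proj₂ (proj₂ (rep-ex a)))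
      ... | inj₂ q = subst (λ z → isRep E z ≡ true) (sym (==-sound q)) (proj₂ (proj₂ (rep-ex b)))

    comps-one : ∀ a → (∀ v → connected E a v ≡ true) → components E ≡ 1
    comps-one a h = trans (count-cong (isRep E) (λ x → x == ra) (allFin n) pt) (count-eq1 n ra)
      where
      ra = proj₁ (rep-ex a)
      pt : ∀ x → isRep E x ≡ (x == ra)
      pt x = bool-ext (λ p → subst (λ z → (x == z) ≡ true) (rep-uniq x ra p (proj₂ (proj₂ (rep-ex a))) (ct {x} {a} {ra} (cs {a} {x} (h x)) (proj₁ (proj₂ (rep-ex a))))) (==-refl x))
                      (λ p → subst (λ z → isRep E z ≡ true) (sym (==-sound p)) (proj₂ (proj₂ (rep-ex a))))

    comps-two : ∀ a b → connected E a b ≡ false → (∀ v → connected E a v ≡ true ⊎ connected E b v ≡ true) → components E ≡ 2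
    comps-two a b nab h = trans (count-cong (isRep E) (λ x → (x == ra) ∨ (x == rb)) (allFin n) pt) (count-eq2 n ra rb (rep-neq a b nab))
      where
      ra = proj₁ (rep-ex a)
      rb = proj₁ (rep-ex b)
      pt : ∀ x → isRep E x ≡ ((x == ra) ∨ (x == rb))
      pt x = bool-ext f g
        where
        f : isRep E x ≡ true → (x == ra) ∨ (x == rb) ≡ true
        f p with h x
        ... | inj₁ c = ∨-l _ (subst (λ z → (x == z) ≡ true) (rep-uniq x ra p (proj₂ (proj₂ (rep-ex a))) (ct {x} {a} {ra} (cs {a} {x} c) (proj₁ (proj₂ (rep-ex a))))) (==-refl x))
        ... | inj₂ c = ∨-r (x == ra) (subst (λ z → (x == z) ≡ true) (rep-uniq x rb p (proj₂ (proj₂ (rep-ex b))) (ct {x} {b} {rb} (cs {b} {x} c) (proj₁ (proj₂ (rep-ex b))))) (==-refl x))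
        g : (x == ra) ∨ (x == rb) ≡ true → isRep E x ≡ true
        g p with ∨-el {x == ra} p
        ... | inj₁ q = subst (λ z → isRep E z ≡ true) (sym (==-sound q)) (proj₂ (proj₂ (rep-ex a)))
        ... | inj₂ q = subst (λ z → isRep E z ≡ true) (sym (==-sound q)) (proj₂ (proj₂ (rep-ex b)))

    comps1⇒ : components E ≡ 1 → ∀ a v → connected E a v ≡ true
    comps1⇒ c1 a v with connected E a v in eq
    ... | true = refl
    ... | false = ⊥-elim (NP.<-irrefl (sym c1) (comps-ge2 a v eq))

    comps2⇒ : components E ≡ 2 → ∀ a b → connected E a b ≡ false → ∀ v → connected E a v ≡ true ⊎ connected E b v ≡ true
    comps2⇒ c2 a b nab v with connected E a v in e1 | connected E b v in e2
    ... | true | _ = inj₁ refl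
    ... | false | true = inj₂ refl
    ... | false | false = ⊥-elim (NP.<-irrefl (sym c2) (comps-ge3 a b v nab e1 e2))

  isTree : ∀ {n} → Graph n → Bool
  isTree E = isForest E ∧ (components E ≡ᵇ 1)

  isTwoForest : ∀ {n} → Graph n → Bool
  isTwoForest E = isForest E ∧ (components E ≡ᵇ 2)

  ≡ᵇ-sound : ∀ {m k} → (m ≡ᵇ k) ≡ true → m ≡ k
  ≡ᵇ-sound {m} {k} p = NP.≡ᵇ⇒≡ m k (≡⇒T p)

  ≡ᵇ-in : ∀ {m k} → m ≡ k → (m ≡ᵇ k) ≡ true
  ≡ᵇ-in {m} refl = T⇒≡ (NP.≡⇒≡ᵇ m m refl)

module EdgeAddition where

  open import Defs
  open Basics
  open Walks
  open Cycles
  open Components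
  open import Data.Bool using (true; false; _∧_; _∨_; not)
  open import Data.Nat using (ℕ; zero; suc; _≡ᵇ_)
  open import Data.Fin using (Fin)
  open import Data.List using (_∷_; allFin)
  open import Data.Product using (_×_; _,_)
  open import Data.Sum using (_⊎_; inj₁; inj₂)
  open import Data.Empty using (⊥-elim)
  open import Relation.Nullary using (¬_)
  open import Relation.Binary.PropositionalEquality

  module _ {n : ℕ} (G : Graph n) (a b : Fin n) where

    private
      T' = (a , b) ∷ G
      cr = conn-refl {E = G}
      cstep = λ {x} {y} {z} → conn-step {E = G} {x} {y} {z}

    -- In T' = (a , b) ∷ G, u reaches v either inside G or by crossing the
    -- new edge once (a walk crossing it twice can be shortcut).
    ReachViaEdge : Fin n → Fin n → Set
    ReachViaEdge u v = connected G u v ≡ true ⊎ (connected G u a ≡ true × connected G b v ≡ true) ⊎ (connected G u b ≡ true × connected G a v ≡ true)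

    reachViaEdge-step : ∀ u x v → ReachViaEdge u x → adj T' x v ≡ true → ReachViaEdge u v
    reachViaEdge-step u x v p ad with ∨-el {eAdj (a , b) x v} ad
    reachViaEdge-step u x v (inj₁ c) ad | inj₂ g = inj₁ (cstep {u} {x} {v} c g)
    reachViaEdge-step u x v (inj₂ (inj₁ (c1 , c2))) ad | inj₂ g = inj₂ (inj₁ (c1 , cstep {b} {x} {v} c2 g))
    reachViaEdge-step u x v (inj₂ (inj₂ (c1 , c2))) ad | inj₂ g = inj₂ (inj₂ (c1 , cstep {a} {x} {v} c2 g))
    reachViaEdge-step u x v p ad | inj₁ ea with eAdj-el a b x v ea
    reachViaEdge-step u x v (inj₁ c) ad | inj₁ ea | inj₁ (refl , refl) = inj₂ (inj₁ (c , cr b))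
    reachViaEdge-step u x v (inj₂ (inj₁ (c1 , c2))) ad | inj₁ ea | inj₁ (refl , refl) = inj₂ (inj₁ (c1 , cr b))
    reachViaEdge-step u x v (inj₂ (inj₂ (c1 , c2))) ad | inj₁ ea | inj₁ (refl , refl) = inj₁ c1
    reachViaEdge-step u x v (inj₁ c) ad | inj₁ ea | inj₂ (refl , refl) = inj₂ (inj₂ (c , cr a))
    reachViaEdge-step u x v (inj₂ (inj₁ (c1 , c2))) ad | inj₁ ea | inj₂ (refl , refl) = inj₁ c1
    reachViaEdge-step u x v (inj₂ (inj₂ (c1 , c2))) ad | inj₁ ea | inj₂ (refl , refl) = inj₂ (inj₂ (c1 , cr a))

    reach⇒reachViaEdge : ∀ k u v → reachW T' k u v ≡ true → ReachViaEdge u v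
    reach⇒reachViaEdge zero u v r = inj₁ (subst (λ z → connected G u z ≡ true) (==-sound r) (cr u))
    reach⇒reachViaEdge (suc k) u v r with ∨-el {reachW T' k u v} r
    ... | inj₁ r' = reach⇒reachViaEdge k u v r'
    ... | inj₂ r' with any-el _ (allFin n) r'
    ... | x , _ , xa = reachViaEdge-step u x v (reach⇒reachViaEdge k u x (∧-l {reachW T' k u x} xa)) (∧-r {reachW T' k u x} xa)

    R-lift : ∀ k u v → reachW G k u v ≡ true → reachW T' k u v ≡ true
    R-lift zero u v r = r
    R-lift (suc k) u v r with ∨-el {reachW G k u v} r
    ... | inj₁ r' = R-up {E = T'} k u v (R-lift k u v r')
    ... | inj₂ r' with any-el _ (allFin n) r'
    ... | x , _ , xa = R-step {E = T'} k u x v (R-lift k u x (∧-l {reachW G k u x} xa)) (adj-mono (a , b) G x v (∧-r {reachW G k u x} xa))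

    conn-lift : ∀ u v → connected G u v ≡ true → connected T' u v ≡ true
    conn-lift u v = R-lift n u v

    conn-T-ab : connected T' a b ≡ true
    conn-T-ab = conn-adj {E = T'} {a} {b} (∨-l (adj G a b) (∨-l _ (∧-in (==-refl a) (==-refl b))))

    addEdge-tree⇒twoForest : ¬ a ≡ b → adj G a b ≡ false → isTree T' ≡ true →
      (isTwoForest G ∧ not (connected G a b)) ≡ true
    addEdge-tree⇒twoForest a≢b nadj p = ∧-in (∧-in (not-f acyclicG) (≡ᵇ-in twoComps)) (not-f nab)
      where
      acyclicT : hasCycle T' ≡ false
      acyclicT = not-t (∧-l {isForest T'} p)
      oneComp : components T' ≡ 1
      oneComp = ≡ᵇ-sound (∧-r {isForest T'} p)
      acyclicG : hasCycle G ≡ false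
      acyclicG with hasCycle G in eq
      ... | false = refl
      ... | true = ⊥-elim (true≢false (hasCycle-mono (a , b) G eq) acyclicT)
      nab : connected G a b ≡ false
      nab with connected G a b in eq
      ... | false = refl
      ... | true = ⊥-elim (true≢false (cyc-from-conn G a b a≢b nadj eq) acyclicT)
      aOrB : ∀ v → connected G a v ≡ true ⊎ connected G b v ≡ true
      aOrB v with reach⇒reachViaEdge n a v (comps1⇒ T' oneComp a v)
      ... | inj₁ c = inj₁ c
      ... | inj₂ (inj₁ (_ , c)) = inj₂ c
      ... | inj₂ (inj₂ (c , _)) = ⊥-elim (true≢false c nab)
      twoComps : components G ≡ 2
      twoComps = comps-two G a b nab aOrB

    twoForest⇒addEdge-tree : ¬ a ≡ b → (isTwoForest G ∧ not (connected G a b)) ≡ true → isTree T' ≡ true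
    twoForest⇒addEdge-tree a≢b p = ∧-in (not-f acyclicT) (≡ᵇ-in (comps-one T' a allFromA))
      where
      nab : connected G a b ≡ false
      nab = not-t (∧-r {isTwoForest G} p)
      acyclicG : hasCycle G ≡ false
      acyclicG = not-t (∧-l {isForest G} (∧-l {isTwoForest G} p))
      twoComps : components G ≡ 2
      twoComps = ≡ᵇ-sound (∧-r {isForest G} (∧-l {isTwoForest G} p))
      acyclicT : hasCycle T' ≡ false
      acyclicT with hasCycle T' in eq
      ... | false = refl
      ... | true with hasCycle-ext G a b a≢b eq
      ... | inj₁ q = ⊥-elim (true≢false q acyclicG)
      ... | inj₂ q = ⊥-elim (true≢false q nab)
      allFromA : ∀ v → connected T' a v ≡ true
      allFromA v with comps2⇒ G twoComps a b nab v
      ... | inj₁ c = conn-lift a v c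
      ... | inj₂ c = conn-trans {E = T'} {a} {b} {v} conn-T-ab (conn-lift b v c)

    isTree-addEdge : ¬ a ≡ b → adj G a b ≡ false → isTree T' ≡ (isTwoForest G ∧ not (connected G a b))
    isTree-addEdge a≢b nadj = bool-ext (addEdge-tree⇒twoForest a≢b nadj) (twoForest⇒addEdge-tree a≢b)

module Complements where

  open import Defs
  open Sums
  open import Data.Rational using (ℚ; _+_; _*_)
  open import Data.Rational.Properties as ℚP using ()
  open import Data.List using (List; []; _∷_; map; _++_)
  open import Data.Product using (_×_; _,_; proj₁; proj₂)
  open import Data.Sum using (inj₁; inj₂)
  open import Relation.Binary.PropositionalEquality
  open import Data.List.Membership.Propositional using (_∈_)
  open import Data.List.Membership.Propositional.Properties using (∈-map⁻; ∈-++⁻)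
  open import Data.List.Relation.Unary.Any using (here; there)
  open import Data.List.Relation.Unary.All as All using ([]; _∷_)
  open import Data.List.Relation.Unary.AllPairs using ([]; _∷_)
  open import Data.List.Relation.Unary.Unique.Propositional using (Unique)
  open import Data.Empty using (⊥)
  open import Data.Rational.Solver using (module +-*-Solver)
  open +-*-Solver

  toComplement : ∀ {A : Set} → A → List A × List A → List A × List A
  toComplement x p = proj₁ p , x ∷ proj₂ p

  toSubset : ∀ {A : Set} → A → List A × List A → List A × List A
  toSubset x p = x ∷ proj₁ p , proj₂ p

  withComplements : ∀ {A : Set} → List A → List (List A × List A)
  withComplements [] = ([] , []) ∷ []
  withComplements (x ∷ xs) = map (toComplement x) (withComplements xs) ++ map (toSubset x) (withComplements xs)

  Σ-withComplements : ∀ {A : Set} (F : List A → ℚ) xs → Σ (λ p → F (proj₁ p)) (withComplements xs) ≡ Σ F (sublists xs)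
  Σ-withComplements F [] = refl
  Σ-withComplements F (x ∷ xs) = begin
      Σ (λ p → F (proj₁ p)) (map (toComplement x) (withComplements xs) ++ map (toSubset x) (withComplements xs))
    ≡⟨ Σ-++ (λ p → F (proj₁ p)) (map (toComplement x) (withComplements xs)) _ ⟩
      Σ (λ p → F (proj₁ p)) (map (toComplement x) (withComplements xs)) + Σ (λ p → F (proj₁ p)) (map (toSubset x) (withComplements xs))
    ≡⟨ cong₂ _+_ (trans (Σ-map (λ p → F (proj₁ p)) (toComplement x) (withComplements xs)) (Σ-withComplements F xs)) (trans (Σ-map (λ p → F (proj₁ p)) (toSubset x) (withComplements xs)) (Σ-withComplements (λ T → F (x ∷ T)) xs)) ⟩
      Σ F (sublists xs) + Σ (λ T → F (x ∷ T)) (sublists xs)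
    ≡⟨ cong (λ r → Σ F (sublists xs) + r) (sym (Σ-map F (x ∷_) (sublists xs))) ⟩
      Σ F (sublists xs) + Σ F (map (x ∷_) (sublists xs))
    ≡⟨ sym (Σ-++ F (sublists xs) _) ⟩
      Σ F (sublists (x ∷ xs)) ∎
    where open ≡-Reasoning

  Σ-splits-cons : ∀ {A : Set} (g : A → List A → ℚ) x T → Σ (λ p → g (proj₁ p) (proj₂ p)) (splits (x ∷ T)) ≡ g x T + Σ (λ p → g (proj₁ p) (x ∷ proj₂ p)) (splits T)
  Σ-splits-cons g x T = cong (λ r → g x T + r) (Σ-map _ _ (splits T))

  Σ-splits-reindex : ∀ {A : Set} (P : List A) (g : A → List A → ℚ) →
    Σ (λ T → Σ (λ p → g (proj₁ p) (proj₂ p)) (splits T)) (sublists P) ≡ Σ (λ q → Σ (λ e → g e (proj₁ q)) (proj₂ q)) (withComplements P)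
  Σ-splits-reindex [] g = refl
  Σ-splits-reindex (x ∷ xs) g = begin
      LHS
    ≡⟨ Σ-++ (λ T → Σ (λ p → g (proj₁ p) (proj₂ p)) (splits T)) (sublists xs) _ ⟩
      Σ (λ T → Σ (λ p → g (proj₁ p) (proj₂ p)) (splits T)) (sublists xs) + Σ (λ T → Σ (λ p → g (proj₁ p) (proj₂ p)) (splits T)) (map (x ∷_) (sublists xs))
    ≡⟨ cong₂ _+_ (Σ-splits-reindex xs g) (trans (Σ-map (λ T → Σ (λ p → g (proj₁ p) (proj₂ p)) (splits T)) (x ∷_) (sublists xs)) (trans (Σ-cong _ _ (sublists xs) (λ T _ → Σ-splits-cons g x T)) (Σ-+ _ _ (sublists xs)))) ⟩
      R xs g + (Σ (g x) (sublists xs) + Σ (λ T → Σ (λ p → g (proj₁ p) (x ∷ proj₂ p)) (splits T)) (sublists xs))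
    ≡⟨ cong (λ r → R xs g + r) (cong₂ _+_ (sym (Σ-withComplements (g x) xs)) (Σ-splits-reindex xs (λ e G → g e (x ∷ G)))) ⟩
      R xs g + (Σ (λ q → g x (proj₁ q)) (withComplements xs) + R xs (λ e G → g e (x ∷ G)))
    ≡⟨ rearr (R xs g) (Σ (λ q → g x (proj₁ q)) (withComplements xs)) (R xs (λ e G → g e (x ∷ G))) ⟩
      (Σ (λ q → g x (proj₁ q)) (withComplements xs) + R xs g) + R xs (λ e G → g e (x ∷ G))
    ≡⟨ cong (λ r → r + R xs (λ e G → g e (x ∷ G))) (sym (Σ-+ (λ q → g x (proj₁ q)) (λ q → Σ (λ e → g e (proj₁ q)) (proj₂ q)) (withComplements xs))) ⟩
      Σ (λ q → g x (proj₁ q) + Σ (λ e → g e (proj₁ q)) (proj₂ q)) (withComplements xs) + R xs (λ e G → g e (x ∷ G))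
    ≡⟨ cong₂ _+_ (sym (Σ-map (λ q → Σ (λ e → g e (proj₁ q)) (proj₂ q)) (toComplement x) (withComplements xs))) (sym (Σ-map (λ q → Σ (λ e → g e (proj₁ q)) (proj₂ q)) (toSubset x) (withComplements xs))) ⟩
      Σ (λ q → Σ (λ e → g e (proj₁ q)) (proj₂ q)) (map (toComplement x) (withComplements xs)) + Σ (λ q → Σ (λ e → g e (proj₁ q)) (proj₂ q)) (map (toSubset x) (withComplements xs))
    ≡⟨ sym (Σ-++ (λ q → Σ (λ e → g e (proj₁ q)) (proj₂ q)) (map (toComplement x) (withComplements xs)) _) ⟩
      R (x ∷ xs) g ∎
    where
    open ≡-Reasoning
    LHS = Σ (λ T → Σ (λ p → g (proj₁ p) (proj₂ p)) (splits T)) (sublists (x ∷ xs))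
    R : ∀ ys → (_ → _ → ℚ) → ℚ
    R ys h = Σ (λ q → Σ (λ e → h e (proj₁ q)) (proj₂ q)) (withComplements ys)
    rearr : ∀ a b c → a + (b + c) ≡ (b + a) + c
    rearr = solve 3 (λ a b c → a :+ (b :+ c) := (b :+ a) :+ c) refl

  Σ-complement : ∀ {A : Set} (h : A → ℚ) P q → q ∈ withComplements P → Σ h (proj₁ q) + Σ h (proj₂ q) ≡ Σ h P
  Σ-complement h [] q (here refl) = refl
  Σ-complement h (x ∷ xs) q m with ∈-++⁻ (map (toComplement x) (withComplements xs)) m
  ... | inj₁ m1 with ∈-map⁻ (toComplement x) m1
  ... | (G , C) , m2 , refl = trans (solve 3 (λ a b c → a :+ (b :+ c) := b :+ (a :+ c)) refl (Σ h G) (h x) (Σ h C)) (cong (λ r → h x + r) (Σ-complement h xs _ m2))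
  Σ-complement h (x ∷ xs) q m | inj₂ m1 with ∈-map⁻ (toSubset x) m1
  ... | (G , C) , m2 , refl = trans (ℚP.+-assoc (h x) (Σ h G) (Σ h C)) (cong (λ r → h x + r) (Σ-complement h xs _ m2))

  complement-mem₁ : ∀ {A : Set} P (q : List A × List A) {e} → q ∈ withComplements P → e ∈ proj₁ q → e ∈ P
  complement-mem₁ [] q (here refl) ()
  complement-mem₁ (x ∷ xs) q m me with ∈-++⁻ (map (toComplement x) (withComplements xs)) m
  ... | inj₁ m1 with ∈-map⁻ (toComplement x) m1
  ... | (G , C) , m2 , refl = there (complement-mem₁ xs _ m2 me)
  complement-mem₁ (x ∷ xs) q m me | inj₂ m1 with ∈-map⁻ (toSubset x) m1
  complement-mem₁ (x ∷ xs) q m (here refl) | inj₂ m1 | (G , C) , m2 , refl = here refl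
  complement-mem₁ (x ∷ xs) q m (there me) | inj₂ m1 | (G , C) , m2 , refl = there (complement-mem₁ xs _ m2 me)

  complement-mem₂ : ∀ {A : Set} P (q : List A × List A) {e} → q ∈ withComplements P → e ∈ proj₂ q → e ∈ P
  complement-mem₂ [] q (here refl) ()
  complement-mem₂ (x ∷ xs) q m me with ∈-++⁻ (map (toComplement x) (withComplements xs)) m
  ... | inj₂ m1 with ∈-map⁻ (toSubset x) m1
  ... | (G , C) , m2 , refl = there (complement-mem₂ xs _ m2 me)
  complement-mem₂ (x ∷ xs) q m me | inj₁ m1 with ∈-map⁻ (toComplement x) m1
  complement-mem₂ (x ∷ xs) q m (here refl) | inj₁ m1 | (G , C) , m2 , refl = here refl
  complement-mem₂ (x ∷ xs) q m (there me) | inj₁ m1 | (G , C) , m2 , refl = there (complement-mem₂ xs _ m2 me)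

  complement-disjoint : ∀ {A : Set} (P : List A) → Unique P → ∀ q {e} → q ∈ withComplements P → e ∈ proj₁ q → e ∈ proj₂ q → ⊥
  complement-disjoint [] [] q (here refl) () m2
  complement-disjoint (x ∷ xs) (x∉ ∷ u) q m m1 m2 with ∈-++⁻ (map (toComplement x) (withComplements xs)) m
  ... | inj₁ mm with ∈-map⁻ (toComplement x) mm
  complement-disjoint (x ∷ xs) (x∉ ∷ u) q m m1 (here refl) | inj₁ mm | (G , C) , m' , refl = All.lookup x∉ (complement-mem₁ xs (G , C) m' m1) refl
  complement-disjoint (x ∷ xs) (x∉ ∷ u) q m m1 (there m2) | inj₁ mm | (G , C) , m' , refl = complement-disjoint xs u (G , C) m' m1 m2
  complement-disjoint (x ∷ xs) (x∉ ∷ u) q m m1 m2 | inj₂ mm with ∈-map⁻ (toSubset x) mm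
  complement-disjoint (x ∷ xs) (x∉ ∷ u) q m (here refl) m2 | inj₂ mm | (G , C) , m' , refl = All.lookup x∉ (complement-mem₂ xs (G , C) m' m2) refl
  complement-disjoint (x ∷ xs) (x∉ ∷ u) q m (there m1) m2 | inj₂ mm | (G , C) , m' , refl = complement-disjoint xs u (G , C) m' m1 m2

-- Removing an edge e from a graph T (a 'split' (e , G) of T, G = T − e)
-- only reorders edges, so adjacency, degrees, mass, acyclicity and the
-- number of components of T agree with those of e ∷ G.
module EdgeRemoval where

  open import Defs
  open Basics
  open Cycles
  open Components
  open Complements
  open import Data.Bool using (Bool; true; false; _∧_; _∨_; not; if_then_else_; T)
  open import Data.Bool.Properties as BP using ()
  open import Data.Nat as ℕ using (ℕ; zero; suc; _<_; _<ᵇ_; _≡ᵇ_)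
  open import Data.Nat.Properties as NP using ()
  open import Data.Fin using (Fin; toℕ)
  open import Data.List using (List; []; _∷_; map; length; allFin; filterᵇ)
  open import Data.Bool.ListAction using (any)
  open import Data.Product using (_×_; _,_; proj₁; proj₂)
  open import Data.Product.Properties using (,-injectiveʳ)
  open import Data.Sum using (inj₁; inj₂)
  open import Data.Empty using (⊥-elim)
  open import Relation.Nullary using (¬_)
  open import Relation.Binary.PropositionalEquality
  open import Data.List.Membership.Propositional using (_∈_)
  open import Data.List.Membership.Propositional.Properties using (∈-map⁻; ∈-concat⁻′; ∈-filter⁻)
  open import Data.List.Relation.Unary.Any using (here; there)
  open import Data.List.Relation.Unary.All as All using (All; []; _∷_)
  import Data.List.Relation.Unary.All.Properties as AllP
  import Data.List.Relation.Unary.AllPairs as AP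
  open AP using ([]; _∷_)
  import Data.List.Relation.Unary.AllPairs.Properties as APP
  open import Data.List.Relation.Unary.Unique.Propositional using (Unique)
  import Data.List.Relation.Unary.Unique.Propositional.Properties as UP

  any-splits : ∀ {A : Set} (p : A → Bool) T e G → (e , G) ∈ splits T → any p T ≡ (p e ∨ any p G)
  any-splits p (x ∷ xs) e G (here refl) = refl
  any-splits p (x ∷ xs) e G (there m) with ∈-map⁻ (λ q → proj₁ q , x ∷ proj₂ q) m
  ... | (e' , G') , m' , refl rewrite any-splits p xs e' G' m' =
    trans (sym (BP.∨-assoc (p x) (p e') (any p G'))) (trans (cong (_∨ any p G') (BP.∨-comm (p x) (p e'))) (BP.∨-assoc (p e') (p x) (any p G')))

  count-swap : ∀ {A : Set} (p : A → Bool) x y ys → count p (x ∷ y ∷ ys) ≡ count p (y ∷ x ∷ ys)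
  count-swap p x y ys
    rewrite count-cons p x (y ∷ ys) | count-cons p y (x ∷ ys) | count-cons p y ys | count-cons p x ys
    with p x | p y
  ... | true | true = refl
  ... | true | false = refl
  ... | false | true = refl
  ... | false | false = refl

  count-∷-cong : ∀ {A : Set} (p : A → Bool) x {xs ys} → count p xs ≡ count p ys → count p (x ∷ xs) ≡ count p (x ∷ ys)
  count-∷-cong p x eq with p x
  ... | true = cong suc eq
  ... | false = eq

  count-splits : ∀ {A : Set} (p : A → Bool) T e G → (e , G) ∈ splits T → count p T ≡ count p (e ∷ G)
  count-splits p (x ∷ xs) e G (here refl) = refl
  count-splits p (x ∷ xs) e G (there m) with ∈-map⁻ (λ q → proj₁ q , x ∷ proj₂ q) m
  ... | (e' , G') , m' , refl = trans (count-∷-cong p x (count-splits p xs e' G' m')) (count-swap p x e' G')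

  module _ {n : ℕ} (E E' : Graph n) (h : ∀ u v → adj E u v ≡ adj E' u v) where

    reach-ext : ∀ k u v → reachW E k u v ≡ reachW E' k u v
    reach-ext zero u v = refl
    reach-ext (suc k) u v = cong₂ _∨_ (reach-ext k u v) (any-cong _ _ (allFin n) (λ x _ → cong₂ _∧_ (reach-ext k u x) (h x v)))

    path-ext : ∀ xs → pathAdj E xs ≡ pathAdj E' xs
    path-ext [] = refl
    path-ext (x ∷ []) = refl
    path-ext (x ∷ y ∷ xs) = cong₂ _∧_ (h x y) (path-ext (y ∷ xs))

    cyc-ext : ∀ c → isCycle E c ≡ isCycle E' c
    cyc-ext [] = refl
    cyc-ext (v ∷ vs) = cong (λ z → (2 <ᵇ length (v ∷ vs)) ∧ distinct (v ∷ vs) ∧ z) (cong₂ _∧_ (path-ext (v ∷ vs)) (h (last v vs) v))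

    forest-ext : isForest E ≡ isForest E'
    forest-ext = cong not (any-cong _ _ (Data.List.upTo (suc n)) (λ k _ → any-cong _ _ (vlists n k) (λ c _ → cyc-ext c)))

    comps-ext : components E ≡ components E'
    comps-ext = count-cong _ _ (allFin n) (λ v → cong not (any-cong _ _ (allFin n) (λ u _ → cong ((u <F v) ∧_) (reach-ext n v u))))

  module _ {n : ℕ} (T : Graph n) (e : Edge n) (G : Graph n) (m : (e , G) ∈ splits T) where

    adj-splits : ∀ u v → adj T u v ≡ adj (e ∷ G) u v
    adj-splits u v = any-splits _ T e G m

    deg-splits : ∀ i → deg T i ≡ deg (e ∷ G) i
    deg-splits i = count-splits _ T e G m

    mass-splits : ∀ (w : Weights n) → mass w T ≡ mass w (e ∷ G)
    mass-splits w = cong prodℕ (Data.List.Properties.map-cong (λ i → cong (w i ℕ.^_) (deg-splits i)) (allFin n))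
      where import Data.List.Properties

    forest-splits : isForest T ≡ isForest (e ∷ G)
    forest-splits = forest-ext T (e ∷ G) adj-splits

    comps-splits : components T ≡ components (e ∷ G)
    comps-splits = comps-ext T (e ∷ G) adj-splits

    isTree-splits : isTree T ≡ isTree (e ∷ G)
    isTree-splits = cong₂ _∧_ forest-splits (cong (_≡ᵇ 1) comps-splits)

  pairsOf : ∀ {n} → Fin n → List (Edge n)
  pairsOf {n} u = map (λ v → (u , v)) (filterᵇ (u <F_) (allFin n))

  allPairs-sorted : ∀ {n} (e : Edge n) → e ∈ allPairs n → toℕ (proj₁ e) < toℕ (proj₂ e)
  allPairs-sorted {n} e m with ∈-concat⁻′ (map pairsOf (allFin n)) m
  ... | ys , m1 , m2 with ∈-map⁻ pairsOf m2
  ... | u , _ , refl with ∈-map⁻ (λ v → (u , v)) m1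
  ... | v , m3 , refl = <F-sound u v (T⇒≡ (proj₂ (∈-filter⁻ (λ x → Data.Bool.T? (u <F x)) {xs = allFin n} m3)))
    where import Data.Bool

  allPairs-unique : ∀ n → Unique (allPairs n)
  allPairs-unique n = UP.concat⁺ allU disj
    where
    allU : All Unique (map pairsOf (allFin n))
    allU = AllP.map⁺ (All.tabulate (λ {u} _ → UP.map⁺ (λ eq → ,-injectiveʳ eq) (UP.filter⁺ (λ x → Data.Bool.T? (u <F x)) (UP.allFin⁺ n))))
      where import Data.Bool
    fst : ∀ {u : Fin n} {e} → e ∈ pairsOf u → proj₁ e ≡ u
    fst {u} m with ∈-map⁻ (λ v → (u , v)) m
    ... | v , _ , refl = refl
    disj : AP.AllPairs _ (map pairsOf (allFin n))
    disj = APP.map⁺ (AP.map (λ {u} {u'} u≢u' {_} (m1 , m2) → u≢u' (trans (sym (fst m1)) (fst m2))) (UP.allFin⁺ n))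

  module _ {n : ℕ} (q : Graph n × Graph n) (mq : q ∈ withComplements (allPairs n)) (a b : Fin n) (me : (a , b) ∈ proj₂ q) where

    newEdge-sorted : toℕ a < toℕ b
    newEdge-sorted = allPairs-sorted (a , b) (complement-mem₂ (allPairs n) q mq me)

    newEdge-≢ : ¬ a ≡ b
    newEdge-≢ refl = NP.<-irrefl refl newEdge-sorted

    newEdge-nonadjacent : adj (proj₁ q) a b ≡ false
    newEdge-nonadjacent with adj (proj₁ q) a b in eq
    ... | false = refl
    ... | true with any-el _ (proj₁ q) eq
    ... | (g₁ , g₂) , mg , r with eAdj-el g₁ g₂ a b r
    ... | inj₁ (refl , refl) = ⊥-elim (complement-disjoint (allPairs n) (allPairs-unique n) q mq mg me)
    ... | inj₂ (refl , refl) = ⊥-elim (NP.<-asym newEdge-sorted (allPairs-sorted (g₁ , g₂) (complement-mem₁ (allPairs n) q mq mg)))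

-- Natural-number sums and products over lists, and the mass identity
-- mass ((a , b) ∷ G) = mass G · w a · w b: adding an edge raises the degrees
-- of its two (distinct) endpoints by one.
module NatLists where

  open import Defs
  open Basics
  open Components
  open import Data.Bool using (Bool; true; false; _∧_; _∨_; if_then_else_)
  open import Data.Nat using (ℕ; suc; _≤_; _+_; _*_; _^_)
  open import Data.Nat.Properties as NP using ()
  open import Data.Fin as Fin using (Fin)
  open import Data.List using ([]; _∷_; map; allFin; filterᵇ)
  open import Data.Product using (_,_)
  open import Data.Empty using (⊥-elim)
  open import Relation.Nullary using (¬_)
  open import Relation.Binary.PropositionalEquality
  open import Data.List.Membership.Propositional using (_∈_)
  open import Data.List.Relation.Unary.Any using (here; there)
  import Data.List.Properties as LP
  open import Data.Nat.Solver using (module +-*-Solver)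
  open +-*-Solver

  filter-cong : ∀ {A : Set} (p q : A → Bool) xs → (∀ x → p x ≡ q x) → filterᵇ p xs ≡ filterᵇ q xs
  filter-cong p q [] h = refl
  filter-cong p q (x ∷ xs) h with p x | q x | h x
  ... | true | true | _ = cong (x ∷_) (filter-cong p q xs h)
  ... | false | false | _ = filter-cong p q xs h

  sum-split : ∀ {A : Set} (f : A → ℕ) (p q : A → Bool) xs → (∀ x → p x ∧ q x ≡ false) → (∀ x → p x ∨ q x ≡ true) →
    sumℕ (map f (filterᵇ p xs)) + sumℕ (map f (filterᵇ q xs)) ≡ sumℕ (map f xs)
  sum-split f p q [] h1 h2 = refl
  sum-split f p q (x ∷ xs) h1 h2 with p x | q x | h1 x | h2 x
  ... | true | false | _ | _ = trans (NP.+-assoc (f x) _ _) (cong (f x +_) (sum-split f p q xs h1 h2))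
  ... | false | true | _ | _ = trans (solve 3 (λ a b c → a :+ (b :+ c) := b :+ (a :+ c)) refl (sumℕ (map f (filterᵇ p xs))) (f x) _) (cong (f x +_) (sum-split f p q xs h1 h2))

  sum-mem : ∀ {A : Set} (f : A → ℕ) {x} xs → x ∈ xs → f x ≤ sumℕ (map f xs)
  sum-mem f (y ∷ ys) (here refl) = NP.m≤m+n (f y) _
  sum-mem f (y ∷ ys) (there m) = NP.≤-trans (sum-mem f ys m) (NP.m≤n+m _ (f y))

  filter-mem : ∀ {A : Set} (p : A → Bool) {x} xs → x ∈ xs → p x ≡ true → x ∈ filterᵇ p xs
  filter-mem p (y ∷ ys) (here refl) px with p y
  ... | true = here refl
  filter-mem p (y ∷ ys) (here refl) () | false
  filter-mem p (y ∷ ys) (there m) px with p y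
  ... | true = there (filter-mem p ys m px)
  ... | false = filter-mem p ys m px

  prod-* : ∀ {A : Set} (f g : A → ℕ) xs → prodℕ (map (λ x → f x * g x) xs) ≡ prodℕ (map f xs) * prodℕ (map g xs)
  prod-* f g [] = refl
  prod-* f g (x ∷ xs) rewrite prod-* f g xs = solve 4 (λ a b c d → (a :* b) :* (c :* d) := (a :* c) :* (b :* d)) refl (f x) (g x) (prodℕ (map f xs)) (prodℕ (map g xs))

  prod-1 : ∀ {A : Set} (f : A → ℕ) xs → (∀ x → f x ≡ 1) → prodℕ (map f xs) ≡ 1
  prod-1 f [] h = refl
  prod-1 f (x ∷ xs) h rewrite h x | prod-1 f xs h = refl

  prod-single : ∀ n (a : Fin n) (c : ℕ) → prodℕ (map (λ i → if i == a then c else 1) (allFin n)) ≡ c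
  prod-single (suc n) a c = trans (cong (λ l → prodℕ (map (λ i → if i == a then c else 1) l)) (allFin-suc n)) (by-position a)
    where
    by-position : ∀ a → prodℕ (map (λ i → if i == a then c else 1) (Fin.zero ∷ map Fin.suc (allFin n))) ≡ c
    by-position Fin.zero = trans (cong₂ _*_ (cong (λ b → if b then c else 1) (==-refl (Fin.zero {n})))
                     (trans (cong prodℕ (sym (LP.map-∘ (allFin n))))
                        (prod-1 _ (allFin n) (λ i → cong (λ b → if b then c else 1) (==-false {u = Fin.suc i} {v = Fin.zero} (λ ()))))))
                  (NP.*-identityʳ c)
    by-position (Fin.suc a') = trans (cong₂ _*_ (cong (λ b → if b then c else 1) (==-false {u = Fin.zero} {v = Fin.suc a'} (λ ())))
                     (trans (cong prodℕ (sym (LP.map-∘ (allFin n))))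
                       (trans (cong prodℕ (LP.map-cong (λ i → cong (λ b → if b then c else 1) (suc==suc i a')) (allFin n))) (prod-single n a' c))))
                  (NP.+-identityʳ c)

  module _ {n : ℕ} (w : Weights n) where

    deg-cons : ∀ (a b : Fin n) G i → deg ((a , b) ∷ G) i ≡ (if (a == i) ∨ (b == i) then suc (deg G i) else deg G i)
    deg-cons a b G i = count-cons _ (a , b) G

    mass-cons : ∀ (a b : Fin n) G → ¬ a ≡ b → mass w ((a , b) ∷ G) ≡ mass w G * (w a * w b)
    mass-cons a b G a≢b = begin
        prodℕ (map (λ i → w i ^ deg ((a , b) ∷ G) i) (allFin n))
      ≡⟨ cong prodℕ (LP.map-cong degree-factor (allFin n)) ⟩
        prodℕ (map (λ i → (w i ^ deg G i) * ((if i == a then w a else 1) * (if i == b then w b else 1))) (allFin n))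
      ≡⟨ prod-* _ _ (allFin n) ⟩
        mass w G * prodℕ (map (λ i → (if i == a then w a else 1) * (if i == b then w b else 1)) (allFin n))
      ≡⟨ cong (mass w G *_) (trans (prod-* _ _ (allFin n)) (cong₂ _*_ (prod-single n a (w a)) (prod-single n b (w b)))) ⟩
        mass w G * (w a * w b) ∎
      where
      open ≡-Reasoning
      degree-factor : ∀ i → w i ^ deg ((a , b) ∷ G) i ≡ (w i ^ deg G i) * ((if i == a then w a else 1) * (if i == b then w b else 1))
      degree-factor i rewrite deg-cons a b G i | ==-sym a i | ==-sym b i with i == a in e1 | i == b in e2
      ... | true | true = ⊥-elim (a≢b (trans (sym (==-sound e1)) (==-sound e2)))
      ... | true | false rewrite ==-sound e1 = trans (NP.*-comm (w a) _) (cong (w a ^ deg G a *_) (sym (NP.*-identityʳ (w a))))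
      ... | false | true rewrite ==-sound e2 = trans (NP.*-comm (w b) _) (cong (λ z → w b ^ deg G b * z) (sym (NP.+-identityʳ (w b))))
      ... | false | false = sym (NP.*-identityʳ _)

-- For G = T − (a , b), with a and b in the two
-- different components A ∋ a, B ∋ b of G, the quantity s = w(s(T,e)) is one
-- of w(A), w(B) and at most both; since w(A) + w(B) = W this gives
--   1 ≤ s ≤ W/2   and   s · (W − s) = w(A) · w(B).
module SmallSide where

  open import Defs
  open Basics
  open Walks
  open Components
  open NatLists
  open import Data.Bool using (Bool; true; false; _∧_; _∨_; if_then_else_)
  open import Data.Nat using (ℕ; zero; suc; _≤_; _<_; _+_; _*_; _<ᵇ_; _∸_)
  open import Data.Nat.Properties as NP using ()
  open import Data.Nat.DivMod using (_/_; m*n/n≡m; /-monoˡ-≤)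
  open import Data.Fin as Fin using (Fin)
  open import Data.List using (map; allFin; filterᵇ)
  open import Data.Product using (_×_; _,_; proj₁; proj₂)
  open import Data.Sum using (_⊎_; inj₁; inj₂)
  open import Data.Empty using (⊥-elim)
  open import Relation.Binary.PropositionalEquality
  open import Data.List.Membership.Propositional.Properties using (∈-allFin)

  sRoot-choice : ∀ {A : Set} (f : A → ℕ) (a b : A) (c : Bool) →
    let r = (if f a <ᵇ f b then a else (if f b <ᵇ f a then b else (if c then a else b))) in
    (f r ≡ f a ⊎ f r ≡ f b) × (f r ≤ f a) × (f r ≤ f b)
  sRoot-choice f a b c with f a <ᵇ f b in e1
  ... | true = inj₁ refl , NP.≤-refl , NP.<⇒≤ (NP.<ᵇ⇒< (f a) (f b) (≡⇒T e1))
  ... | false with f b <ᵇ f a in e2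
  ... | true = inj₂ refl , NP.<⇒≤ (NP.<ᵇ⇒< (f b) (f a) (≡⇒T e2)) , NP.≤-refl
  ... | false with c
  ... | true = inj₁ refl , NP.≤-refl , NP.≮⇒≥ (λ p → true≢false (T⇒≡ (NP.<⇒<ᵇ p)) e2)
  ... | false = inj₂ refl , NP.≮⇒≥ (λ p → true≢false (T⇒≡ (NP.<⇒<ᵇ p)) e1) , NP.≤-refl

  module _ {n : ℕ} (w : Weights n) (wpos : ∀ i → 1 ≤ w i) (G : Graph n) where

    compW : Fin n → ℕ
    compW v = compWeight w G v

    W : ℕ
    W = totalWeight w

    private
      ct = λ {x} {y} {z} → conn-trans {E = G} {x} {y} {z}
      cs = λ {x} {y} → conn-sym {E = G} {x} {y}

    compW-cong : ∀ u v → connected G u v ≡ true → compW u ≡ compW v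
    compW-cong u v c = cong (λ l → sumℕ (map w l)) (filter-cong (connected G u) (connected G v) (allFin n)
      (λ x → bool-ext (λ p → ct {v} {u} {x} (cs {u} {v} c) p) (λ p → ct {u} {v} {x} c p)))

    compW-pos : ∀ v → 1 ≤ compW v
    compW-pos v = NP.≤-trans (wpos v) (sum-mem w (filterᵇ (connected G v) (allFin n)) (filter-mem (connected G v) (allFin n) (∈-allFin v) (conn-refl {E = G} v)))

    module _ (c2 : components G ≡ 2) where

      compW-split : ∀ a b → connected G a b ≡ false → compW a + compW b ≡ W
      compW-split a b nab = sum-split w (connected G a) (connected G b) (allFin n) h1 h2
        where
        h1 : ∀ x → connected G a x ∧ connected G b x ≡ false
        h1 x with connected G a x in e1 | connected G b x in e2
        ... | true | true = ⊥-elim (true≢false (ct {a} {x} {b} e1 (cs {b} {x} e2)) nab)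
        ... | true | false = refl
        ... | false | _ = refl
        h2 : ∀ x → connected G a x ∨ connected G b x ≡ true
        h2 x with comps2⇒ G c2 a b nab x
        ... | inj₁ p = ∨-l _ p
        ... | inj₂ p = ∨-r (connected G a x) p

    smallW : Fin n → Fin n → ℕ
    smallW a b = sWeight w (a , b) G

    smallW-cases : ∀ a b → (smallW a b ≡ compW a ⊎ smallW a b ≡ compW b) × (smallW a b ≤ compW a) × (smallW a b ≤ compW b)
    smallW-cases a b = go n refl a b
      where
      -- sRoot is defined by cases on n, so we expose n's shape.
      go : ∀ m → m ≡ n → (a b : Fin n) → (smallW a b ≡ compW a ⊎ smallW a b ≡ compW b) × (smallW a b ≤ compW a) × (smallW a b ≤ compW b)
      go zero refl ()
      go (suc m) refl a b = sRoot-choice compW a b (connected G a Fin.zero)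

    module _ (c2 : components G ≡ 2) (a b : Fin n) (nab : connected G a b ≡ false) where

      smallW-product : smallW a b * (W ∸ smallW a b) ≡ compW a * compW b
      smallW-product with proj₁ (smallW-cases a b)
      ... | inj₁ e rewrite e = cong (compW a *_) (trans (cong (_∸ compW a) (sym (compW-split c2 a b nab))) (NP.m+n∸m≡n (compW a) (compW b)))
      ... | inj₂ e rewrite e = trans (cong (compW b *_) (trans (cong (_∸ compW b) (sym (compW-split c2 a b nab))) (NP.m+n∸n≡m (compW a) (compW b)))) (NP.*-comm (compW b) (compW a))

      smallW-half : smallW a b ≤ W / 2
      smallW-half = begin
          s             ≡⟨ sym (m*n/n≡m s 2) ⟩
          s * 2 / 2     ≤⟨ /-monoˡ-≤ 2 twice-s≤W ⟩
          W / 2         ∎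
        where
        open NP.≤-Reasoning
        s = smallW a b
        twice-s≤W : s * 2 ≤ W
        twice-s≤W = begin
            s * 2                ≡⟨ NP.*-comm s 2 ⟩
            s + (s + 0)          ≡⟨ cong (s +_) (NP.+-identityʳ s) ⟩
            s + s                ≤⟨ NP.+-mono-≤ (proj₁ (proj₂ (smallW-cases a b))) (proj₂ (proj₂ (smallW-cases a b))) ⟩
            compW a + compW b    ≡⟨ compW-split c2 a b nab ⟩
            W                    ∎

      smallW-pos : 1 ≤ smallW a b
      smallW-pos with proj₁ (smallW-cases a b)
      ... | inj₁ e rewrite e = compW-pos a
      ... | inj₂ e rewrite e = compW-pos b

module CrossingPairs where

  open import Defs
  open Basics
  open Sums
  open Walks
  open Components
  open EdgeRemoval using (pairsOf)
  open NatLists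
  open SmallSide
  open import Data.Bool using (Bool; true; false; _∧_; _∨_; not; if_then_else_)
  open import Data.Bool.Properties as BP using ()
  open import Data.Nat as ℕ using (ℕ; _≤_; _<_)
  open import Data.Nat.Properties as NP using ()
  open import Data.Rational using (ℚ; 0ℚ; _+_; _*_)
  open import Data.Rational.Properties as ℚP using ()
  open import Data.Fin using (Fin; toℕ)
  open import Data.Fin.Properties as FinP using ()
  open import Data.List using (map; allFin; filterᵇ)
  open import Data.Bool.ListAction using (any)
  open import Data.Product using (_,_)
  open import Data.Sum using (inj₁; inj₂)
  open import Data.Empty using (⊥; ⊥-elim)
  open import Relation.Nullary using (¬_)
  open import Relation.Binary using (tri<; tri≈; tri>)
  open import Relation.Binary.PropositionalEquality
  open import Data.List.Membership.Propositional.Properties using (∈-allFin)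
  open import Function using (_∘_)

  pairs-sum : ∀ {n} (F : Edge n → ℚ) → Σ F (allPairs n) ≡ Σ (λ u → Σ (λ v → if u <F v then F (u , v) else 0ℚ) (allFin n)) (allFin n)
  pairs-sum {n} F = trans (Σ-concatMap F pairsOf (allFin n)) (Σ-cong _ _ (allFin n) (λ u _ → trans (Σ-map F (λ v → (u , v)) (filterᵇ (u <F_) (allFin n))) (Σ-filter (λ v → F (u , v)) (u <F_) (allFin n))))

  crossWeight : ∀ {n} → Weights n → Graph n → Edge n → ℚ
  crossWeight w G (a , b) = if not (connected G a b) then ι (w a ℕ.* w b) else 0ℚ

  module _ {n : ℕ} (w : Weights n) (wpos : ∀ i → 1 ≤ w i) (G : Graph n) (c2 : components G ≡ 2) (z : Fin n) where

    private
      ct = λ {x} {y} {z} → conn-trans {E = G} {x} {y} {z}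
      cs = λ {x} {y} → conn-sym {E = G} {x} {y}

    χ : Fin n → Bool
    χ v = connected G z v

    X Y : ℕ
    X = compW w wpos G z
    Y = sumℕ (map w (filterᵇ (not ∘ χ) (allFin n)))

    XY-sum : X ℕ.+ Y ≡ W w wpos G
    XY-sum = sum-split w χ (not ∘ χ) (allFin n) (λ x → BP.∧-inverseʳ (χ x)) (λ x → BP.∨-inverseʳ (χ x))

    both-f : ∀ u v → χ u ≡ false → χ v ≡ false → connected G u v ≡ true
    both-f u v fu fv with comps2⇒ G c2 z u fu v
    ... | inj₁ p = ⊥-elim (true≢false p fv)
    ... | inj₂ p = p

    cross-prod : ∀ a b → connected G a b ≡ false → compW w wpos G a ℕ.* compW w wpos G b ≡ X ℕ.* Y
    cross-prod a b nab with χ a in ea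
    ... | true = cong₂ ℕ._*_ (sym (compW-cong w wpos G z a ea)) cb
      where
      cb : compW w wpos G b ≡ Y
      cb = NP.+-cancelˡ-≡ X _ _ (trans (cong (ℕ._+ compW w wpos G b) (compW-cong w wpos G z a ea)) (trans (compW-split w wpos G c2 a b nab) (sym XY-sum)))
    ... | false with χ b in eb
    ... | false = ⊥-elim (true≢false (both-f a b ea eb) nab)
    ... | true = trans (NP.*-comm (compW w wpos G a) (compW w wpos G b)) (cong₂ ℕ._*_ (sym (compW-cong w wpos G z b eb)) ca)
      where
      ca : compW w wpos G a ≡ Y
      ca = NP.+-cancelˡ-≡ X _ _ (trans (cong (ℕ._+ compW w wpos G a) (compW-cong w wpos G z b eb)) (trans (NP.+-comm (compW w wpos G b) _) (trans (compW-split w wpos G c2 a b nab) (sym XY-sum))))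

    X-pos : 1 ≤ X
    X-pos = compW-pos w wpos G z

    Y-pos : 1 ≤ Y
    Y-pos with any (λ v → not (χ v)) (allFin n) in eq
    ... | true with any-el _ (allFin n) eq
    ... | v , _ , nv = NP.≤-trans (wpos v) (sum-mem w (filterᵇ (not ∘ χ) (allFin n)) (filter-mem (not ∘ χ) (allFin n) (∈-allFin v) nv))
    Y-pos | false = ⊥-elim (abs (trans (sym (comps-one G z (λ v → h v))) c2))
      where
      abs : 1 ≡ 2 → ⊥
      abs ()
      h : ∀ v → connected G z v ≡ true
      h v with χ v in ev
      ... | true = refl
      ... | false = ⊥-elim (true≢false (any-in (λ v → not (χ v)) (∈-allFin v) (not-f ev)) eq)

    H : Fin n → Fin n → ℚ
    H u v = if χ u ∧ not (χ v) then ι (w u) * ι (w v) else 0ℚ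

    cross-H : ∀ u v → (if not (connected G u v) then ι (w u ℕ.* w v) else 0ℚ) ≡ H u v + H v u
    cross-H u v with χ u in eu | χ v in ev
    ... | true | true rewrite ct {u} {z} {v} (cs {z} {u} eu) ev = refl
    ... | false | false rewrite both-f u v eu ev = refl
    ... | true | false = trans (cong (λ b → if not b then ι (w u ℕ.* w v) else 0ℚ) nuv) (trans (ι-* (w u) (w v)) (sym (ℚP.+-identityʳ _)))
      where
      nuv : connected G u v ≡ false
      nuv with connected G u v in e
      ... | false = refl
      ... | true = ⊥-elim (true≢false (ct {z} {u} {v} eu e) ev)
    ... | false | true = trans (cong (λ b → if not b then ι (w u ℕ.* w v) else 0ℚ) nuv) (trans (ι-* (w u) (w v)) (trans (ℚP.*-comm (ι (w u)) _) (sym (ℚP.+-identityˡ _))))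
      where
      nuv : connected G u v ≡ false
      nuv with connected G u v in e
      ... | false = refl
      ... | true = ⊥-elim (true≢false (ct {z} {v} {u} ev (cs {u} {v} e)) eu)

    private
      if-+ : ∀ (b : Bool) x y → (if b then x + y else 0ℚ) ≡ (if b then x else 0ℚ) + (if b then y else 0ℚ)
      if-+ true x y = refl
      if-+ false x y = refl

      not-lt : ∀ (a b : Fin n) → ¬ (toℕ a < toℕ b) → (a <F b) ≡ false
      not-lt a b h with a <F b in e
      ... | false = refl
      ... | true = ⊥-elim (h (<F-sound a b e))

      tri : ∀ u v → (if u <F v then H u v else 0ℚ) + (if v <F u then H u v else 0ℚ) ≡ H u v
      tri u v with FinP.<-cmp u v
      ... | tri< lt _ ¬gt rewrite <F-in u v lt | not-lt v u ¬gt = ℚP.+-identityʳ _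
      ... | tri> ¬lt _ gt rewrite <F-in v u gt | not-lt u v ¬lt = ℚP.+-identityˡ _
      ... | tri≈ _ refl _ = trans (cong₂ _+_ (irr u) (irr u)) (sym (Hdiag u))
        where
        irr : ∀ a → (if a <F a then H a a else 0ℚ) ≡ 0ℚ
        irr a with a <F a in e
        ... | false = refl
        ... | true = ⊥-elim (NP.<-irrefl refl (<F-sound a a e))
        Hdiag : ∀ a → H a a ≡ 0ℚ
        Hdiag a with χ a
        ... | true = refl
        ... | false = refl

      If Jf : Fin n → ℚ
      If u = if χ u then ι (w u) else 0ℚ
      Jf v = if not (χ v) then ι (w v) else 0ℚ

      H-IJ : ∀ u v → H u v ≡ If u * Jf v
      H-IJ u v with χ u | χ v
      ... | true | true = sym (ℚP.*-zeroʳ (ι (w u)))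
      ... | true | false = refl
      ... | false | true = sym (ℚP.*-zeroˡ 0ℚ)
      ... | false | false = sym (ℚP.*-zeroˡ (ι (w v)))

      ιX : ι X ≡ Σ If (allFin n)
      ιX = trans (ι-sum w (filterᵇ χ (allFin n))) (Σ-filter (ι ∘ w) χ (allFin n))

      ιY : ι Y ≡ Σ Jf (allFin n)
      ιY = trans (ι-sum w (filterᵇ (not ∘ χ) (allFin n))) (Σ-filter (ι ∘ w) (not ∘ χ) (allFin n))

    crossing-symmetrise : Σ (crossWeight w G) (allPairs n) ≡ Σ (λ u → Σ (H u) (allFin n)) (allFin n)
    crossing-symmetrise = begin
        Σ (crossWeight w G) (allPairs n)
      ≡⟨ pairs-sum (crossWeight w G) ⟩
        Σ (λ u → Σ (λ v → if u <F v then crossWeight w G (u , v) else 0ℚ) (allFin n)) (allFin n)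
      ≡⟨ Σ-cong _ _ (allFin n) (λ u _ → trans (Σ-cong _ _ (allFin n) (λ v _ → trans (cong (λ x → if u <F v then x else 0ℚ) (cross-H u v)) (if-+ (u <F v) (H u v) (H v u))))
                                              (Σ-+ (λ v → if u <F v then H u v else 0ℚ) (λ v → if u <F v then H v u else 0ℚ) (allFin n))) ⟩
        Σ (λ u → below u + Σ (λ v → if u <F v then H v u else 0ℚ) (allFin n)) (allFin n)
      ≡⟨ Σ-+ below (λ u → Σ (λ v → if u <F v then H v u else 0ℚ) (allFin n)) (allFin n) ⟩
        Σ below (allFin n) + Σ (λ u → Σ (λ v → if u <F v then H v u else 0ℚ) (allFin n)) (allFin n)
      ≡⟨ cong (Σ below (allFin n) +_) (Σ-swap (λ u v → if u <F v then H v u else 0ℚ) (allFin n) (allFin n)) ⟩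
        Σ below (allFin n) + Σ above (allFin n)
      ≡⟨ sym (Σ-+ below above (allFin n)) ⟩
        Σ (λ u → below u + above u) (allFin n)
      ≡⟨ Σ-cong _ _ (allFin n) (λ u _ → trans (sym (Σ-+ (λ v → if u <F v then H u v else 0ℚ) (λ v → if v <F u then H u v else 0ℚ) (allFin n)))
                                              (Σ-cong _ _ (allFin n) (λ v _ → tri u v))) ⟩
        Σ (λ u → Σ (H u) (allFin n)) (allFin n) ∎
      where
      open ≡-Reasoning
      below above : Fin n → ℚ
      below u = Σ (λ v → if u <F v then H u v else 0ℚ) (allFin n)
      above u = Σ (λ v → if v <F u then H u v else 0ℚ) (allFin n)

    cross-sum : Σ (crossWeight w G) (allPairs n) ≡ ι X * ι Y
    cross-sum = begin
        Σ (crossWeight w G) (allPairs n)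
      ≡⟨ crossing-symmetrise ⟩
        Σ (λ u → Σ (H u) (allFin n)) (allFin n)
      ≡⟨ Σ-cong _ _ (allFin n) (λ u _ → trans (Σ-cong _ _ (allFin n) (λ v _ → H-IJ u v)) (Σ-*ˡ (If u) Jf (allFin n))) ⟩
        Σ (λ u → If u * Σ Jf (allFin n)) (allFin n)
      ≡⟨ Σ-*ʳ (Σ Jf (allFin n)) If (allFin n) ⟩
        Σ If (allFin n) * Σ Jf (allFin n)
      ≡⟨ sym (cong₂ _*_ ιX ιY) ⟩
        ι X * ι Y ∎
      where open ≡-Reasoning

module Indicators where

  open import Defs
  open Sums
  open Components using (T⇒≡; ≡⇒T)
  open import Data.Bool using (Bool; true; false; _∧_; if_then_else_)
  open import Data.Nat as ℕ using (ℕ; _≡ᵇ_)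
  open import Data.Nat.Properties as NP using ()
  open import Data.Rational using (ℚ; 0ℚ; 1ℚ; _+_; _*_)
  open import Data.Rational.Properties as ℚP using ()
  open import Data.List using ([]; _∷_; map; filterᵇ)
  open import Relation.Binary.PropositionalEquality
  open import Data.List.Membership.Propositional using (_∈_)
  open import Data.List.Relation.Unary.Any using (here; there)
  open import Data.List.Relation.Unary.All as All using ([]; _∷_)
  open import Data.List.Relation.Unary.AllPairs using ([]; _∷_)
  open import Data.List.Relation.Unary.Unique.Propositional using (Unique)
  open import Data.Empty using (⊥-elim)

  Σ-filter2 : ∀ {A : Set} (f : A → ℚ) (p q : A → Bool) xs → Σ f (filterᵇ q (filterᵇ p xs)) ≡ Σ (λ x → if p x ∧ q x then f x else 0ℚ) xs
  Σ-filter2 f p q xs = trans (Σ-filter f q (filterᵇ p xs)) (trans (Σ-filter _ p xs) (Σ-cong _ _ xs (λ x _ → h (f x) (p x) (q x))))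
    where
    h : ∀ y b c → (if b then (if c then y else 0ℚ) else 0ℚ) ≡ (if b ∧ c then y else 0ℚ)
    h y true c = refl
    h y false c = refl

  pick : ∀ (f : ℕ → ℚ) k xs → Unique xs → k ∈ xs → Σ (λ j → (if k ≡ᵇ j then 1ℚ else 0ℚ) * f j) xs ≡ f k
  pick f k (x ∷ xs) (x∉ ∷ u) (here refl) rewrite T⇒≡ (NP.≡⇒≡ᵇ x x refl) =
    trans (cong₂ _+_ (ℚP.*-identityˡ (f x)) (Σ-0 _ xs (λ j m → trans (cong (λ b → (if b then 1ℚ else 0ℚ) * f j) (neq j m)) (ℚP.*-zeroˡ (f j))))) (ℚP.+-identityʳ (f x))
    where
    neq : ∀ j → j ∈ xs → (x ≡ᵇ j) ≡ false
    neq j m with x ≡ᵇ j in e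
    ... | false = refl
    ... | true = ⊥-elim (All.lookup x∉ m (NP.≡ᵇ⇒≡ x j (≡⇒T e)))
  pick f k (x ∷ xs) (x∉ ∷ u) (there m) with k ≡ᵇ x in e
  ... | true = ⊥-elim (All.lookup x∉ (subst (_∈ xs) (NP.≡ᵇ⇒≡ k x (≡⇒T e)) m) refl)
  ... | false = trans (cong (_+ Σ (λ j → (if k ≡ᵇ j then 1ℚ else 0ℚ) * f j) xs) (ℚP.*-zeroˡ (f x))) (trans (ℚP.+-identityˡ _) (pick f k xs u m))

  sum0-mul : ∀ {A : Set} (f g : A → ℕ) xs → sumℕ (map f xs) ≡ 0 → sumℕ (map (λ x → f x ℕ.* g x) xs) ≡ 0
  sum0-mul f g [] h = refl
  sum0-mul f g (x ∷ xs) h rewrite NP.m+n≡0⇒m≡0 (f x) h = sum0-mul f g xs (NP.m+n≡0⇒n≡0 (f x) h)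

module Assembly where

  open import Defs
  open Basics
  open Sums
  open Walks
  open Components using (isTree; isTwoForest; ≡ᵇ-sound)
  open EdgeAddition
  open Complements
  open EdgeRemoval
  open NatLists
  open SmallSide hiding (W)
  open CrossingPairs
  open Indicators
  open import Data.Bool using (true; false; _∧_; _∨_; not; if_then_else_)
  open import Data.Nat as ℕ using (ℕ; zero; suc; _≤_; s≤s; _≡ᵇ_; _∸_)
  open import Data.Nat.Properties as NP using ()
  open import Data.Nat.DivMod using (_/_)
  open import Data.Rational using (ℚ; 0ℚ; 1ℚ; _+_; _*_)
  open import Data.Rational.Properties as ℚP using ()
  open import Data.Fin using (Fin)
  open import Data.List using (List; _∷_; map; upTo)
  open import Data.Product using (_×_; _,_; proj₁; proj₂)
  open import Relation.Binary.PropositionalEquality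
  open import Data.List.Membership.Propositional using (_∈_)
  open import Data.List.Membership.Propositional.Properties using (∈-upTo⁺)
  import Data.List.Relation.Unary.Unique.Propositional.Properties as UP
  open import Data.Rational.Solver using (module +-*-Solver)
  open +-*-Solver

  cancel-denominator : ∀ m x → 1 ≤ x → (ι m * inv x) * ι x ≡ ι m
  cancel-denominator m (suc k) _ = begin
      (ι m * inv (suc k)) * ι (suc k)   ≡⟨ ℚP.*-assoc (ι m) (inv (suc k)) (ι (suc k)) ⟩
      ι m * (inv (suc k) * ι (suc k))   ≡⟨ cong (ι m *_) (trans (ℚP.*-comm (inv (suc k)) (ι (suc k))) (ι-inv k)) ⟩
      ι m * 1ℚ                          ≡⟨ ℚP.*-identityʳ (ι m) ⟩
      ι m                               ∎
    where open ≡-Reasoning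

  -- Dividing an identity K₂ = Σ_j S_j · x_j of natural numbers by K, and
  -- normalising each S_j by K₁ (harmless when K₁ = 0, as then all S_j = 0):
  --   K₂/K = (K₁/K) · Σ_j (S_j/K₁) · x_j.
  divide-by-K : ∀ (K K₁ K₂ : ℕ) (S : ℕ → ℕ) (js : List ℕ) (x : ℕ → ℚ) →
    ι K₂ ≡ Σ (λ j → ι (S j) * x j) js → (K₁ ≡ 0 → ∀ j → S j ≡ 0) →
    frac K₂ K ≡ frac K₁ K * Σ (λ j → frac (S j) K₁ * x j) js
  divide-by-K K zero K₂ S js x key S≡0 = begin
      frac K₂ K                                 ≡⟨ frac-ι K₂ K ⟩
      ι K₂ * inv K                              ≡⟨ cong (_* inv K) (trans key (Σ-0 _ js (λ j _ → trans (cong (λ t → ι t * x j) (S≡0 refl j)) (ℚP.*-zeroˡ (x j))))) ⟩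
      0ℚ * inv K                                ≡⟨ ℚP.*-zeroˡ (inv K) ⟩
      0ℚ                                        ≡⟨ sym (ℚP.*-zeroʳ (frac 0 K)) ⟩
      frac 0 K * 0ℚ                             ≡⟨ cong (frac 0 K *_) (sym (Σ-0 _ js (λ j _ → ℚP.*-zeroˡ (x j)))) ⟩
      frac 0 K * Σ (λ j → frac (S j) 0 * x j) js ∎
    where open ≡-Reasoning
  divide-by-K K (suc k) K₂ S js x key _ = begin
      frac K₂ K
    ≡⟨ frac-ι K₂ K ⟩
      ι K₂ * inv K
    ≡⟨ sym (trans (cong (_* (ι K₂ * inv K)) (ι-inv k)) (ℚP.*-identityˡ _)) ⟩
      (ι (suc k) * inv (suc k)) * (ι K₂ * inv K)
    ≡⟨ solve 4 (λ a b c d → (a :* b) :* (c :* d) := (a :* d) :* (b :* c)) refl (ι (suc k)) (inv (suc k)) (ι K₂) (inv K) ⟩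
      (ι (suc k) * inv K) * (inv (suc k) * ι K₂)
    ≡⟨ cong₂ _*_ (sym (frac-ι (suc k) K)) (cong (inv (suc k) *_) key) ⟩
      frac (suc k) K * (inv (suc k) * Σ (λ j → ι (S j) * x j) js)
    ≡⟨ cong (frac (suc k) K *_) (sym (Σ-*ˡ (inv (suc k)) (λ j → ι (S j) * x j) js)) ⟩
      frac (suc k) K * Σ (λ j → inv (suc k) * (ι (S j) * x j)) js
    ≡⟨ cong (frac (suc k) K *_) (Σ-cong _ _ js (λ j _ → trans (sym (ℚP.*-assoc (inv (suc k)) _ _)) (cong (_* x j) (trans (ℚP.*-comm (inv (suc k)) (ι (S j))) (sym (frac-ι (S j) (suc k))))))) ⟩
      frac (suc k) K * Σ (λ j → frac (S j) (suc k) * x j) js ∎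
    where open ≡-Reasoning

  -- z is an arbitrary vertex, used to name one component of each two-forest.
  module Main {n : ℕ} (w : Weights n) (wpos : ∀ i → 1 ≤ w i) (z : Fin n) where

    W M : ℕ
    W = totalWeight w
    M = W / 2

    pairInv : ℕ → ℚ
    pairInv j = frac 1 (suc j ℕ.* (W ∸ suc j))

    sideFactor : Edge n → Graph n → ℚ
    sideFactor e G = Σ (λ j → (if sWeight w e G ≡ᵇ suc j then 1ℚ else 0ℚ) * pairInv j) (upTo M)

    sideFactor-value : ∀ s → 1 ≤ s → s ≤ M → Σ (λ j → (if s ≡ᵇ suc j then 1ℚ else 0ℚ) * pairInv j) (upTo M) ≡ frac 1 (s ℕ.* (W ∸ s))
    sideFactor-value (suc k) (s≤s _) le = pick pairInv k (upTo M) (UP.upTo⁺ M) (∈-upTo⁺ le)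

    treeTerm : Edge n → Graph n → ℚ
    treeTerm e G = if isTree (e ∷ G) then ι (mass w (e ∷ G)) * sideFactor e G else 0ℚ

    treeTerm-if : ∀ e G {b} → isTree (e ∷ G) ≡ b → treeTerm e G ≡ (if b then ι (mass w (e ∷ G)) * sideFactor e G else 0ℚ)
    treeTerm-if e G eq = cong (λ t → if t then ι (mass w (e ∷ G)) * sideFactor e G else 0ℚ) eq

    module TwoForest (q : Graph n × Graph n) (mq : q ∈ withComplements (allPairs n))
                     (twoF : isTwoForest (proj₁ q) ≡ true) where

      G C : Graph n
      G = proj₁ q
      C = proj₂ q

      twoComps : components G ≡ 2
      twoComps = ≡ᵇ-sound (∧-r {isForest G} twoF)

      wA wB : ℕ
      wA = X w wpos G twoComps z
      wB = Y w wpos G twoComps z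

      share : ℚ
      share = ι (mass w G) * inv (wA ℕ.* wB)

      addEdge-isTree : ∀ a b → (a , b) ∈ C → isTree ((a , b) ∷ G) ≡ not (connected G a b)
      addEdge-isTree a b me = trans (isTree-addEdge G a b (newEdge-≢ q mq a b me) (newEdge-nonadjacent q mq a b me))
                                    (cong (_∧ not (connected G a b)) twoF)

      treeTerm-crossing : ∀ a b → (a , b) ∈ C → connected G a b ≡ false → treeTerm (a , b) G ≡ share * ι (w a ℕ.* w b)
      treeTerm-crossing a b me nab = begin
          treeTerm (a , b) G
        ≡⟨ treeTerm-if (a , b) G (trans (addEdge-isTree a b me) (cong not nab)) ⟩
          ι (mass w ((a , b) ∷ G)) * sideFactor (a , b) G
        ≡⟨ cong₂ _*_ (trans (cong ι (mass-cons w a b G (newEdge-≢ q mq a b me))) (ι-* (mass w G) (w a ℕ.* w b)))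
                     (trans (sideFactor-value (smallW w wpos G a b) (smallW-pos w wpos G twoComps a b nab) (smallW-half w wpos G twoComps a b nab))
                            (cong inv (trans (smallW-product w wpos G twoComps a b nab) (cross-prod w wpos G twoComps z a b nab)))) ⟩
          (ι (mass w G) * ι (w a ℕ.* w b)) * inv (wA ℕ.* wB)
        ≡⟨ solve 3 (λ m p i → (m :* p) :* i := (m :* i) :* p) refl (ι (mass w G)) (ι (w a ℕ.* w b)) (inv (wA ℕ.* wB)) ⟩
          share * ι (w a ℕ.* w b) ∎
        where open ≡-Reasoning

      treeTerm-complement : ∀ a b → (a , b) ∈ C → treeTerm (a , b) G ≡ share * crossWeight w G (a , b)
      treeTerm-complement a b me = by-connectivity (connected G a b) refl
        where
        by-connectivity : ∀ c → connected G a b ≡ c → treeTerm (a , b) G ≡ share * crossWeight w G (a , b)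
        by-connectivity true ab = trans (treeTerm-if (a , b) G (trans (addEdge-isTree a b me) (cong not ab)))
                                        (sym (trans (cong (λ t → share * (if not t then ι (w a ℕ.* w b) else 0ℚ)) ab) (ℚP.*-zeroʳ share)))
        by-connectivity false nab = trans (treeTerm-crossing a b me nab)
                                          (cong (λ t → share * (if not t then ι (w a ℕ.* w b) else 0ℚ)) (sym nab))

      crossWeight-edges : Σ (crossWeight w G) G ≡ 0ℚ
      crossWeight-edges = Σ-0 _ G (λ { (a , b) me → cong (λ t → if not t then ι (w a ℕ.* w b) else 0ℚ)
                                       (conn-adj {E = G} {a} {b} (any-in _ me (∨-l _ (∧-in (==-refl a) (==-refl b))))) })

      twoForest-recovered : Σ (λ e → treeTerm e G) C ≡ ι (mass w G)
      twoForest-recovered = begin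
          Σ (λ e → treeTerm e G) C
        ≡⟨ Σ-cong _ _ C (λ { (a , b) me → treeTerm-complement a b me }) ⟩
          Σ (λ e → share * crossWeight w G e) C
        ≡⟨ Σ-*ˡ share (crossWeight w G) C ⟩
          share * Σ (crossWeight w G) C
        ≡⟨ cong (share *_) (trans (sym (ℚP.+-identityˡ _)) (cong (_+ Σ (crossWeight w G) C) (sym crossWeight-edges))) ⟩
          share * (Σ (crossWeight w G) G + Σ (crossWeight w G) C)
        ≡⟨ cong (share *_) (trans (Σ-complement (crossWeight w G) (allPairs n) q mq) (cross-sum w wpos G twoComps z)) ⟩
          share * (ι wA * ι wB)
        ≡⟨ cong (share *_) (sym (ι-* wA wB)) ⟩
          share * ι (wA ℕ.* wB)
        ≡⟨ cancel-denominator (mass w G) (wA ℕ.* wB) (NP.*-mono-≤ (X-pos w wpos G twoComps z) (Y-pos w wpos G twoComps z)) ⟩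
          ι (mass w G) ∎
        where open ≡-Reasoning

    complement-sum : ∀ q → q ∈ withComplements (allPairs n) →
      Σ (λ e → treeTerm e (proj₁ q)) (proj₂ q) ≡ (if isTwoForest (proj₁ q) then ι (mass w (proj₁ q)) else 0ℚ)
    complement-sum q mq = by-twoForest (isTwoForest (proj₁ q)) refl
      where
      by-twoForest : ∀ t → isTwoForest (proj₁ q) ≡ t → Σ (λ e → treeTerm e (proj₁ q)) (proj₂ q) ≡ (if t then ι (mass w (proj₁ q)) else 0ℚ)
      by-twoForest true twoF = TwoForest.twoForest-recovered q mq twoF
      by-twoForest false notTwoF = Σ-0 _ (proj₂ q) λ { (a , b) me →
        treeTerm-if (a , b) (proj₁ q) (trans (isTree-addEdge (proj₁ q) a b (newEdge-≢ q mq a b me) (newEdge-nonadjacent q mq a b me))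
                                             (cong (_∧ not (connected (proj₁ q) a b)) notTwoF)) }

    weightedC : ℕ → ℕ
    weightedC i = sumℕ (map (λ T → mass w T ℕ.* c w T i) (forestsWith n 1))

    weightedC-zero : K′ w ≡ 0 → ∀ j → weightedC j ≡ 0
    weightedC-zero h j = sum0-mul (mass w) (λ T → c w T j) (forestsWith n 1) h

    ι-forestsWith : ∀ i (f : Graph n → ℕ) →
      ι (sumℕ (map f (forestsWith n i))) ≡ Σ (λ T → if isForest T ∧ (components T ≡ᵇ i) then ι (f T) else 0ℚ) (allGraphs n)
    ι-forestsWith i f = trans (ι-sum f (forestsWith n i)) (Σ-filter2 (λ T → ι (f T)) isForest (λ F → components F ≡ᵇ i) (allGraphs n))

    treeCount : Graph n → ℕ → ℚ
    treeCount T j = if isTree T then ι (mass w T ℕ.* c w T (suc j)) else 0ℚ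

    tree-expanded : ∀ T → Σ (λ j → treeCount T j * pairInv j) (upTo M) ≡ Σ (λ p → treeTerm (proj₁ p) (proj₂ p)) (splits T)
    tree-expanded T = by-isTree (isTree T) refl
      where
      splitTerm : ∀ {t} → isTree T ≡ t → Edge n × Graph n → ℚ
      splitTerm {t} _ (e , G) = if t then ι (mass w (e ∷ G)) * sideFactor e G else 0ℚ
      splitTerm≡ : ∀ {t} (eq : isTree T ≡ t) p → p ∈ splits T → treeTerm (proj₁ p) (proj₂ p) ≡ splitTerm eq p
      splitTerm≡ eq (e , G) m = treeTerm-if e G (trans (sym (isTree-splits T e G m)) eq)
      indicator : Edge n × Graph n → ℕ → ℚ
      indicator (e , G) j = if sWeight w e G ≡ᵇ suc j then 1ℚ else 0ℚ
      by-isTree : ∀ t (eq : isTree T ≡ t) →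
        Σ (λ j → (if t then ι (mass w T ℕ.* c w T (suc j)) else 0ℚ) * pairInv j) (upTo M) ≡ Σ (λ p → treeTerm (proj₁ p) (proj₂ p)) (splits T)
      by-isTree false eq = trans (Σ-0 _ (upTo M) (λ j _ → ℚP.*-zeroˡ (pairInv j)))
                                 (sym (trans (Σ-cong _ _ (splits T) (splitTerm≡ eq)) (Σ-0 _ (splits T) (λ _ _ → refl))))
      by-isTree true eq = begin
          Σ (λ j → ι (mass w T ℕ.* c w T (suc j)) * pairInv j) (upTo M)
        ≡⟨ Σ-cong _ _ (upTo M) (λ j _ → trans (cong (_* pairInv j) (ι-* (mass w T) (c w T (suc j)))) (ℚP.*-assoc (ι (mass w T)) _ (pairInv j))) ⟩
          Σ (λ j → ι (mass w T) * (ι (c w T (suc j)) * pairInv j)) (upTo M)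
        ≡⟨ Σ-*ˡ (ι (mass w T)) (λ j → ι (c w T (suc j)) * pairInv j) (upTo M) ⟩
          ι (mass w T) * Σ (λ j → ι (c w T (suc j)) * pairInv j) (upTo M)
        ≡⟨ cong (ι (mass w T) *_) (Σ-cong _ _ (upTo M) (λ j _ → trans (cong (_* pairInv j) (ι-count _ (splits T))) (sym (Σ-*ʳ (pairInv j) (λ p → indicator p j) (splits T))))) ⟩
          ι (mass w T) * Σ (λ j → Σ (λ p → indicator p j * pairInv j) (splits T)) (upTo M)
        ≡⟨ cong (ι (mass w T) *_) (Σ-swap (λ j p → indicator p j * pairInv j) (upTo M) (splits T)) ⟩
          ι (mass w T) * Σ (λ p → sideFactor (proj₁ p) (proj₂ p)) (splits T)
        ≡⟨ sym (Σ-*ˡ (ι (mass w T)) (λ p → sideFactor (proj₁ p) (proj₂ p)) (splits T)) ⟩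
          Σ (λ p → ι (mass w T) * sideFactor (proj₁ p) (proj₂ p)) (splits T)
        ≡⟨ Σ-cong _ _ (splits T) (λ { (e , G) m → sym (trans (splitTerm≡ eq (e , G) m) (cong (λ t → ι t * sideFactor e G) (sym (mass-splits T e G m w)))) }) ⟩
          Σ (λ p → treeTerm (proj₁ p) (proj₂ p)) (splits T) ∎
        where open ≡-Reasoning

    twoForestMass-identity : ι (massSum w (forestsWith n 2)) ≡ Σ (λ j → ι (weightedC (suc j)) * pairInv j) (upTo M)
    twoForestMass-identity = sym (begin
        Σ (λ j → ι (weightedC (suc j)) * pairInv j) (upTo M)
      ≡⟨ Σ-cong _ _ (upTo M) (λ j _ → trans (cong (_* pairInv j) (ι-forestsWith 1 (λ T → mass w T ℕ.* c w T (suc j))))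
                                            (sym (Σ-*ʳ (pairInv j) (λ T → treeCount T j) (allGraphs n)))) ⟩
        Σ (λ j → Σ (λ T → treeCount T j * pairInv j) (allGraphs n)) (upTo M)
      ≡⟨ Σ-swap (λ j T → treeCount T j * pairInv j) (upTo M) (allGraphs n) ⟩
        Σ (λ T → Σ (λ j → treeCount T j * pairInv j) (upTo M)) (allGraphs n)
      ≡⟨ Σ-cong _ _ (allGraphs n) (λ T _ → tree-expanded T) ⟩
        Σ (λ T → Σ (λ p → treeTerm (proj₁ p) (proj₂ p)) (splits T)) (allGraphs n)
      ≡⟨ Σ-splits-reindex (allPairs n) treeTerm ⟩
        Σ (λ q → Σ (λ e → treeTerm e (proj₁ q)) (proj₂ q)) (withComplements (allPairs n))
      ≡⟨ Σ-cong _ _ (withComplements (allPairs n)) complement-sum ⟩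
        Σ (λ q → if isTwoForest (proj₁ q) then ι (mass w (proj₁ q)) else 0ℚ) (withComplements (allPairs n))
      ≡⟨ Σ-withComplements (λ T → if isTwoForest T then ι (mass w T) else 0ℚ) (allPairs n) ⟩
        Σ (λ T → if isTwoForest T then ι (mass w T) else 0ℚ) (allGraphs n)
      ≡⟨ sym (ι-forestsWith 2 (mass w)) ⟩
        ι (massSum w (forestsWith n 2)) ∎)
      where open ≡-Reasoning

-- P(𝐅 ∈ 𝓕_{n,2}) = Σ_{two-forests} mass / K, and
-- rhsSum w is, by definition, Σ_{i=1}^{M} (weightedC i / K′) · 1/(i(W−i));
-- so the statement is twoForestMass-identity divided by K (divide-by-K).
-- Any vertex (here the first) may serve as the base point z.
open import Defs
open import Data.Nat using (ℕ; _≤_; suc)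
open import Data.Fin using (Fin; zero)
open import Data.Rational using (ℚ; _*_)
open import Relation.Binary.PropositionalEquality using (_≡_)
open import Data.List using (upTo)
open Assembly using (divide-by-K; module Main)

lemma7 : (n : ℕ) → 2 ≤ n → (w : Fin n → ℕ) → (∀ i → 1 ≤ w i) →
    probForestComponents w 2 ≡ probForestComponents w 1 * rhsSum w
lemma7 (suc m) _ w wpos =
  divide-by-K (K w) (K′ w) (massSum w (forestsWith (suc m) 2))
              (λ j → weightedC (suc j)) (upTo M) pairInv
              twoForestMass-identity
              (λ K′≡0 j → weightedC-zero K′≡0 (suc j))
  where open Main w wpos zero
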